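{- Let $n \geq 6$ be an integer. (a) Let $o_e(n)$ be the number of partitions $q_1 \geq q_2 \geq \cdots \geq q_r$ of $n$ with all parts odd and $\geq 3$, $r \geq 4$, $q_2 = q_3$, $q_r = 3$, and $q_3 > q_4$ unless $q_2 = q_3 = q_4 = 3$, satisfying the following conditions. Put $t = (q_1 - q_2)/2$; for each odd $q \geq 5$ let $u(q)$ be the number of indices $j \in \{4,\dots,r\}$ with $q_j = q$; let $v$ be the number of indices $j \in \{4,\dots,r-1\}$ with $q_j = 3$. (i) If $t > 0$ then $2 \cdot 2^{a} \leq q_3 - 1$, where $2^{a}$ is the largest power of two $\leq t$. (ii) For each odd $q \geq 5$ with $u(q) > 0$, $q \cdot 2^{b} \leq q_3 - 1$, where $2^{b}$ is the largest power of two $\leq u(q)$. (iii) If $v > 0$ then $3 \cdot 2^{c} \leq q_3 - 1$, where $2^{c}$ is the largest power of two $\leq v$. Then $o_e(n) = s_e(n)$. (b) Let $o_o(n)$ be the number of partitions of $n$ that are either the partition $3+3+3$ (when $n = 9$), or a partition $q_1 \geq q_2 \geq \cdots \geq q_r$ with all parts odd and $\geq 3$, $r \geq 3$, $q_1 - q_2 \geq 2$ and $q_3 = q_2 - 2$, satisfying the following conditions. Put $t = (q_1 - q_2 - 2)/2$; for each odd $q \geq 5$ let $u(q)$ be the number of $j \in \{4,\dots,r\}$ with $q_j = q$; let $v$ be the number of $j \in \{4,\dots,r\}$ with $q_j = 3$. (i) If $t > 0$ then $2 \cdot 2^{a} \leq q_3$, where $2^a$ is the largest power of two $\leq t$. (ii)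 For each odd $q \geq 5$ with $u(q) > 0$, $q \cdot 2^{b} \leq q_3$, where $2^b$ is the largest power of two $\leq u(q)$. (iii) If $v > 0$ then $3 \cdot 2^{c} \leq q_3$, where $2^c$ is the largest power of two $\leq v$. Then $o_o(n) = s_o(n)$. (c) $o_e(n) + o_o(n) = s(n)$.
   Context: For $n \geq 0$ let $q(n)$ be the number of partitions of $n$ into distinct parts, with $q(0)=1$, $q(-1)=q(-2)=0$, and $s(n) = q(n) - 2q(n-1) + q(n-2)$. A butterfly partition of $n$ is a partition of $n$ into distinct parts $p_1 > p_2 > \cdots > p_k$ with $k \geq 3$, $p_1 = p_2+1 = p_3+2$ and $p_k \geq 2$. For $n \geq 6$, $s_e(n)$ is the number of butterfly partitions of $n$ whose second largest part $p_2$ is even, and $s_o(n)$ the number of butterfly partitions of $n$ whose second largest part $p_2$ is odd. -}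

module Defs where

open import Data.Nat using (ℕ; zero; suc; _+_; _*_; _∸_; _^_; _≤_; _<_; _>_; _≥_; _≟_)
open import Data.Nat.DivMod using (_/_; _%_)
open import Data.Nat.ListAction using (sum)
open import Data.List using (List; []; _∷_; _++_; [_]; length; filter; last)
open import Data.List.Relation.Unary.All using (All)
open import Data.List.Relation.Unary.Linked using (Linked)
open import Data.List.Relation.Unary.Unique.Propositional using (Unique)
open import Data.List.Membership.Propositional using (_∈_)
open import Data.Maybe using (just)
open import Data.Product using (Σ; ∃; _×_)
open import Data.Sum using (_⊎_)
open import Function.Bundles using (_⇔_)
open import Relation.Binary.PropositionalEquality using (_≡_)

IsPartition : ℕ → List ℕ → Set
IsPartition n l = sum l ≡ n × All (1 ≤_) l × Linked _≥_ l

IsDistinctPartition : ℕ → List ℕ → Set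
IsDistinctPartition n l = sum l ≡ n × All (1 ≤_) l × Linked _>_ l

Count : (List ℕ → Set) → ℕ → Set
Count P m = Σ (List (List ℕ)) λ L → Unique L × (∀ x → (x ∈ L) ⇔ P x) × length L ≡ m

Odd : ℕ → Set
Odd q = q % 2 ≡ 1

Even : ℕ → Set
Even q = q % 2 ≡ 0

OddGe3 : ℕ → Set
OddGe3 q = Odd q × 3 ≤ q

occ : ℕ → List ℕ → ℕ
occ q xs = length (filter (_≟ q) xs)

-- "if x > 0 then k · 2^a ≤ B, where 2^a is the largest power of two ≤ x"
PowCond : ℕ → ℕ → ℕ → Set
PowCond k x B = 0 < x → ∀ a → 2 ^ a ≤ x → x < 2 ^ suc a → k * 2 ^ a ≤ B

Butterfly : ℕ → List ℕ → Set
Butterfly n l = IsDistinctPartition n l ×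
  (∃ λ p₁ → ∃ λ p₂ → ∃ λ p₃ → ∃ λ rest →
     l ≡ p₁ ∷ p₂ ∷ p₃ ∷ rest × p₁ ≡ p₂ + 1 × p₂ ≡ p₃ + 1 ×
     (∀ pk → last l ≡ just pk → 2 ≤ pk))

ButterflyE : ℕ → List ℕ → Set
ButterflyE n l = Butterfly n l × (∃ λ p₁ → ∃ λ p₂ → ∃ λ rest → l ≡ p₁ ∷ p₂ ∷ rest × Even p₂)

ButterflyO : ℕ → List ℕ → Set
ButterflyO n l = Butterfly n l × (∃ λ p₁ → ∃ λ p₂ → ∃ λ rest → l ≡ p₁ ∷ p₂ ∷ rest × Odd p₂)

-- Partitions counted by o_e(n).  Here l = q₁ ∷ q₂ ∷ q₃ ∷ q₄ ∷ rest (so r ≥ 4),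
-- q₄ ∷ rest = mid ++ [ 3 ] encodes q_r = 3, and mid = (q₄, …, q_{r-1}).
OE : ℕ → List ℕ → Set
OE n l = IsPartition n l × All OddGe3 l ×
  (∃ λ q₁ → ∃ λ q₂ → ∃ λ q₃ → ∃ λ q₄ → ∃ λ rest → ∃ λ mid →
     l ≡ q₁ ∷ q₂ ∷ q₃ ∷ q₄ ∷ rest ×
     q₂ ≡ q₃ ×
     q₄ ∷ rest ≡ mid ++ [ 3 ] ×
     (q₃ > q₄ ⊎ (q₂ ≡ 3 × q₃ ≡ 3 × q₄ ≡ 3)) ×
     PowCond 2 ((q₁ ∸ q₂) / 2) (q₃ ∸ 1) ×
     (∀ q → Odd q → 5 ≤ q → PowCond q (occ q (q₄ ∷ rest)) (q₃ ∸ 1)) ×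
     PowCond 3 (occ 3 mid) (q₃ ∸ 1))

OO : ℕ → List ℕ → Set
OO n l = IsPartition n l ×
  (l ≡ 3 ∷ 3 ∷ 3 ∷ [] ⊎
   (All OddGe3 l ×
    (∃ λ q₁ → ∃ λ q₂ → ∃ λ q₃ → ∃ λ rest →
       l ≡ q₁ ∷ q₂ ∷ q₃ ∷ rest ×
       q₁ ∸ q₂ ≥ 2 ×
       q₃ ≡ q₂ ∸ 2 ×
       PowCond 2 ((q₁ ∸ q₂ ∸ 2) / 2) q₃ ×
       (∀ q → Odd q → 5 ≤ q → PowCond q (occ q rest) q₃) ×
       PowCond 3 (occ 3 rest) q₃)))

-- Write every part x ≥ 2 as x = k · 2 ^ j with k = 2 or k odd ≥ 3 (a power of two being 2 · 2 ^ (j - 1)).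
-- Replacing each part of a set of distinct parts in [2, N] by 2 ^ j copies of its base k is a bijection onto
-- the multisets of such bases in which every base k of multiplicity u satisfies k · 2 ^ ⌊log₂ u⌋ ≤ N: the
-- inverse scans x = N, N - 1, …, 2 and takes x whenever 2 ^ j copies of its base are still present, which
-- reads off the binary digits of the multiplicities.  Apply this to the parts below the top run Q + 2, Q + 1, Q
-- of a butterfly partition, with N = Q - 1, and turn the t twos of the multiset into the excess 2t of the
-- largest part: for p₂ even (Q odd) this gives Q + 2t, Q, Q, the odd bases, 3, a partition counted by o_e(n);
-- for p₂ odd it gives Q + 3 + 2t, Q + 1, Q - 1, the odd bases, counted by o_o(n), except that 4 + 3 + 2 goes
-- to 3 + 3 + 3.  For (c), let q₂(m) count the partitions of m into distinct parts ≥ 2, r(m) those among them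
-- whose two largest parts are consecutive and b(m) = s_e(m) + s_o(m) the butterflies.  Deleting a part 1,
-- lowering the largest part, and lowering the two largest parts are bijections showing q(m) = q₂(m) + q₂(m - 1),
-- q₂(m) = r(m) + q₂(m - 1) and r(m) = b(m) + r(m - 2); eliminating q₂ and r gives s(n) = b(n).

module Submission where

open import Defs
open import Data.Empty using (⊥; ⊥-elim)
open import Data.List using (List; []; _∷_; _++_; [_]; length; map; filter; replicate; last)
open import Data.List.Membership.Propositional using (_∈_)
open import Data.List.Membership.Propositional.Properties using (++-∈⇔; ∈-filter⁺; ∈-filter⁻; ∈-map⁺; ∈-map⁻; ∈-++⁺ˡ; ∈-++⁺ʳ; ∈-++⁻)
open import Data.List.Membership.Propositional.Properties.WithK using (unique∧set⇒bag)
open import Data.List.Properties using (length-++; length-map; map-∘; map-id-local; filter-accept; filter-reject; filter-++; filter-all; filter-none; ++-identityʳ)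
open import Data.List.Relation.Binary.BagAndSetEquality using (∼bag⇒↭)
open import Data.List.Relation.Binary.Permutation.Propositional.Properties using (↭-length)
open import Data.List.Relation.Unary.All as All using (All; []; _∷_; all?)
import Data.List.Relation.Unary.All.Properties as All
open import Data.List.Relation.Unary.AllPairs using (AllPairs; []; _∷_)
import Data.List.Relation.Unary.AllPairs.Properties as AllPairs
open import Data.List.Relation.Unary.Any using (here; there)
open import Data.List.Relation.Unary.Linked as Linked using (Linked; []; [-]; _∷_)
open import Data.List.Relation.Unary.Linked.Properties using (Linked⇒All; Linked⇒AllPairs; AllPairs⇒Linked)
open import Data.List.Relation.Unary.Unique.Propositional using (Unique)
import Data.List.Relation.Unary.Unique.Propositional.Properties as Unique
open import Data.Maybe using (just)
open import Data.Nat using (ℕ; zero; suc; pred; _+_; _*_; _∸_; _^_; _≤_; _<_; _>_; _≥_; z≤n; s≤s; _≟_; _≤?_; _<?_; >-nonZero)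
open import Data.Nat.DivMod using (_/_; _%_; m≡m%n+[m/n]*n; [m+kn]%n≡m%n; m*n%n≡0; m%n<n; %-distribˡ-+; m*n/n≡m; m/n<m)
open import Data.Nat.Induction using (<-rec)
open import Data.Nat.ListAction using (sum)
open import Data.Nat.ListAction.Properties using (sum-++)
open import Data.Nat.Properties
open import Algebra.Properties.CommutativeSemigroup +-commutativeSemigroup using (x∙yz≈y∙xz)
open import Data.Nat.Tactic.RingSolver using (solve-∀)
open import Data.Product using (Σ; ∃; _×_; _,_; proj₁; proj₂)
open import Data.Sum using (_⊎_; inj₁; inj₂; [_,_]′)
open import Data.Sum.Function.Propositional using (_⊎-⇔_)
open import Function using (_∘_; case_of_)
open import Function.Bundles using (_⇔_; mk⇔; Equivalence)
import Function.Properties.Equivalence as ⇔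
open import Relation.Binary.PropositionalEquality using (_≡_; _≢_; refl; sym; trans; cong; cong₂; subst; module ≡-Reasoning)
open import Relation.Nullary using (¬_; Dec; yes; no; ¬?)
open import Relation.Nullary.Decidable using (_×-dec_)
open import Relation.Unary using (Decidable)

-- Counting by enumeration

Counted : {A : Set} → (A → Set) → ℕ → Set
Counted {A} P m = Σ (List A) λ L → Unique L × (∀ x → (x ∈ L) ⇔ P x) × length L ≡ m

module _ {A : Set} where

  Counted-unique : ∀ {P : A → Set} {a b} → Counted P a → Counted P b → a ≡ b
  Counted-unique (L , L! , L⇔P , refl) (L′ , L′! , L′⇔P , refl) =
    ↭-length (∼bag⇒↭ (unique∧set⇒bag L! L′! λ {x} → ⇔.trans (L⇔P x) (⇔.sym (L′⇔P x))))

  Counted-cong : ∀ {P Q : A → Set} {m} → (∀ x → P x ⇔ Q x) → Counted P m → Counted Q m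
  Counted-cong P⇔Q (L , L! , L⇔P , |L|) = L , L! , (λ x → ⇔.trans (L⇔P x) (P⇔Q x)) , |L|

  Counted-⊎ : ∀ {P Q : A → Set} {a b} → (∀ x → P x → ¬ Q x) → Counted P a → Counted Q b →
    Counted (λ x → P x ⊎ Q x) (a + b)
  Counted-⊎ disjoint (L , L! , L⇔P , refl) (L′ , L′! , L′⇔Q , refl) =
    L ++ L′ ,
    Unique.++⁺ L! L′! (λ (x∈L , x∈L′) →
      disjoint _ (Equivalence.to (L⇔P _) x∈L) (Equivalence.to (L′⇔Q _) x∈L′)) ,
    (λ x → ⇔.trans ++-∈⇔ (L⇔P x ⊎-⇔ L′⇔Q x)) ,
    length-++ L

module _ {A : Set} {S : A → Set} where

  Counted-filter : ∀ {m} {P : A → Set} → Decidable P → Counted S m → ∃ λ a → Counted (λ x → S x × P x) a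
  Counted-filter P? (L , L! , L⇔S , _) =
    length (filter P? L) , filter P? L , Unique.filter⁺ P? L! ,
    (λ x → mk⇔ (λ x∈ → let (x∈L , Px) = ∈-filter⁻ P? x∈ in Equivalence.to (L⇔S x) x∈L , Px)
               (λ (Sx , Px) → ∈-filter⁺ P? (Equivalence.from (L⇔S x) Sx) Px)) ,
    refl

  Counted-split : ∀ {m} {P : A → Set} → Decidable P → Counted S m →
    Σ ℕ λ a → Σ ℕ λ b → Counted (λ x → S x × P x) a × Counted (λ x → S x × ¬ P x) b × a + b ≡ m
  Counted-split {P = P} P? c with Counted-filter P? c | Counted-filter (¬? ∘ P?) c
  ... | a , cP | b , c¬P = a , b , cP , c¬P ,
    Counted-unique
      (Counted-cong (λ x → mk⇔ [ proj₁ , proj₁ ]′ (decide (P? x))) (Counted-⊎ (λ x p q → proj₂ q (proj₂ p)) cP c¬P)) c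
    where
    decide : ∀ {x} → Dec (P x) → S x → (S x × P x) ⊎ (S x × ¬ P x)
    decide (yes p) s = inj₁ (s , p)
    decide (no ¬p) s = inj₂ (s , ¬p)

module _ {A B : Set} {P : A → Set} {Q : B → Set} where

  Counted-bijection : ∀ {m} (f : A → B) (g : B → A) →
    (∀ x → P x → Q (f x)) → (∀ y → Q y → P (g y)) →
    (∀ x → P x → g (f x) ≡ x) → (∀ y → Q y → f (g y) ≡ y) →
    Counted P m → Counted Q m
  Counted-bijection f g fP gQ gf fg (L , L! , L⇔P , |L|) =
    map f L , Unique.map⁻ (subst Unique (sym gfL) L!) ,
    (λ y → mk⇔ (to y) (λ Qy → subst (_∈ map f L) (fg y Qy) (∈-map⁺ f (Equivalence.from (L⇔P (g y)) (gQ y Qy))))) ,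
    trans (length-map f L) |L|
    where
    gfL : map g (map f L) ≡ L
    gfL = trans (sym (map-∘ L)) (map-id-local (All.tabulate λ {x} x∈L → gf x (Equivalence.to (L⇔P x) x∈L)))
    to : ∀ y → y ∈ map f L → Q y
    to y y∈ with ∈-map⁻ f y∈
    ... | x , x∈L , refl = fP x (Equivalence.to (L⇔P x) x∈L)

-- Partitions into distinct parts

Linked-∷ : ∀ {R : ℕ → ℕ → Set} {x l} → All (R x) l → Linked R l → Linked R (x ∷ l)
Linked-∷ [] _ = [-]
Linked-∷ (Rxy ∷ _) Rl = Rxy ∷ Rl

decreasing⇒below-head : ∀ {x l} → Linked _>_ (x ∷ l) → All (_< x) l
decreasing⇒below-head [-] = []
decreasing⇒below-head (x>y ∷ Rl) = Linked⇒All (λ x>y y>z → <-trans y>z x>y) x>y Rl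

BoundedDistinctPartition : ℕ → ℕ → List ℕ → Set
BoundedDistinctPartition b s l = IsDistinctPartition s l × All (_≤ b) l

distinctPartitions : ℕ → ℕ → List (List ℕ)
distinctPartitions zero zero = [ [] ]
distinctPartitions zero (suc s) = []
distinctPartitions (suc b) s with suc b ≤? s
... | yes _ = distinctPartitions b s ++ map (suc b ∷_) (distinctPartitions b (s ∸ suc b))
... | no _ = distinctPartitions b s

module _ {b s : ℕ} where

  BoundedDistinctPartition-suc : ∀ {l} → BoundedDistinctPartition b s l → BoundedDistinctPartition (suc b) s l
  BoundedDistinctPartition-suc (dp , l≤b) = dp , All.map m≤n⇒m≤1+n l≤b

  BoundedDistinctPartition-∷ : ∀ {l} → suc b ≤ s → BoundedDistinctPartition b (s ∸ suc b) l →
    BoundedDistinctPartition (suc b) s (suc b ∷ l)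
  BoundedDistinctPartition-∷ b<s ((Σl , l≥1 , l>) , l≤b) =
    (trans (cong (suc b +_) Σl) (m+[n∸m]≡n b<s) , s≤s z≤n ∷ l≥1 , Linked-∷ (All.map s≤s l≤b) l>) ,
    ≤-refl ∷ All.map m≤n⇒m≤1+n l≤b

  BoundedDistinctPartition-tail : ∀ {l} → BoundedDistinctPartition (suc b) s (suc b ∷ l) →
    BoundedDistinctPartition b (s ∸ suc b) l
  BoundedDistinctPartition-tail {l} ((Σl , _ ∷ l≥1 , l>) , _) =
    (sym (trans (cong (_∸ suc b) (sym Σl)) (m+n∸m≡n (suc b) (sum l))) , l≥1 , Linked.tail l>) ,
    All.map ≤-pred (decreasing⇒below-head l>)

  BoundedDistinctPartition-pred : ∀ {y l} → BoundedDistinctPartition (suc b) s (y ∷ l) → y ≢ suc b →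
    BoundedDistinctPartition b s (y ∷ l)
  BoundedDistinctPartition-pred (dp@(_ , _ , l>) , y≤1+b ∷ _) y≢1+b =
    dp , y≤b ∷ All.map (λ z<y → ≤-trans (<⇒≤ z<y) y≤b) (decreasing⇒below-head l>)
    where
    y≤b = ≤-pred (≤∧≢⇒< y≤1+b y≢1+b)

∈-distinctPartitions⁻ : ∀ b s {l} → l ∈ distinctPartitions b s → BoundedDistinctPartition b s l
∈-distinctPartitions⁻ zero zero (here refl) = (refl , [] , []) , []
∈-distinctPartitions⁻ (suc b) s l∈ with suc b ≤? s
... | no _ = BoundedDistinctPartition-suc (∈-distinctPartitions⁻ b s l∈)
... | yes b<s with ∈-++⁻ (distinctPartitions b s) l∈
...   | inj₁ l∈′ = BoundedDistinctPartition-suc (∈-distinctPartitions⁻ b s l∈′)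
...   | inj₂ l∈′ with ∈-map⁻ (suc b ∷_) l∈′
...     | _ , l′∈ , refl = BoundedDistinctPartition-∷ b<s (∈-distinctPartitions⁻ b (s ∸ suc b) l′∈)

∈-distinctPartitions⁺ : ∀ b s {l} → BoundedDistinctPartition b s l → l ∈ distinctPartitions b s
∈-distinctPartitions⁺ zero zero {[]} _ = here refl
∈-distinctPartitions⁺ zero (suc s) {[]} ((() , _) , _)
∈-distinctPartitions⁺ zero s {y ∷ l} ((_ , y≥1 ∷ _ , _) , y≤0 ∷ _) = ⊥-elim (<⇒≱ y≥1 y≤0)
∈-distinctPartitions⁺ (suc b) s {[]} ((Σ[] , _) , _) with suc b ≤? s
... | yes _ = ∈-++⁺ˡ (∈-distinctPartitions⁺ b s ((Σ[] , [] , []) , []))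
... | no _ = ∈-distinctPartitions⁺ b s ((Σ[] , [] , []) , [])
∈-distinctPartitions⁺ (suc b) s {y ∷ l} bdp with y ≟ suc b | suc b ≤? s
... | no y≢1+b | yes _ = ∈-++⁺ˡ (∈-distinctPartitions⁺ b s (BoundedDistinctPartition-pred bdp y≢1+b))
... | no y≢1+b | no _ = ∈-distinctPartitions⁺ b s (BoundedDistinctPartition-pred bdp y≢1+b)
... | yes refl | yes _ =
  ∈-++⁺ʳ _ (∈-map⁺ (suc b ∷_) (∈-distinctPartitions⁺ b (s ∸ suc b) (BoundedDistinctPartition-tail bdp)))
... | yes refl | no b≮s = ⊥-elim (b≮s (subst (suc b ≤_) (proj₁ (proj₁ bdp)) (m≤m+n (suc b) (sum l))))

distinctPartitions-unique : ∀ b s → Unique (distinctPartitions b s)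
distinctPartitions-unique zero zero = [] ∷ []
distinctPartitions-unique zero (suc s) = []
distinctPartitions-unique (suc b) s with suc b ≤? s
... | no _ = distinctPartitions-unique b s
... | yes _ = Unique.++⁺ (distinctPartitions-unique b s)
  (Unique.map⁺ (λ { refl → refl }) (distinctPartitions-unique b (s ∸ suc b))) disjoint
  where
  disjoint : ∀ {l} → ¬ (l ∈ distinctPartitions b s × l ∈ map (suc b ∷_) (distinctPartitions b (s ∸ suc b)))
  disjoint (l∈ , l∈′) with ∈-map⁻ (suc b ∷_) l∈′
  ... | _ , _ , refl with ∈-distinctPartitions⁻ b s l∈
  ...   | _ , 1+b≤b ∷ _ = <-irrefl refl 1+b≤b

part≤sum : ∀ l → All (_≤ sum l) l
part≤sum [] = []
part≤sum (x ∷ l) = m≤m+n x (sum l) ∷ All.map (λ y≤ → ≤-trans y≤ (m≤n+m (sum l) x)) (part≤sum l)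

Counted-IsDistinctPartition : ∀ n → ∃ (Counted (IsDistinctPartition n))
Counted-IsDistinctPartition n =
  length (distinctPartitions n n) , distinctPartitions n n , distinctPartitions-unique n n ,
  (λ l → mk⇔ (proj₁ ∘ ∈-distinctPartitions⁻ n n)
             (λ dp@(Σl , _) → ∈-distinctPartitions⁺ n n (dp , subst (λ m → All (_≤ m) l) Σl (part≤sum l)))) ,
  refl

TopRun₂ : List ℕ → Set
TopRun₂ (x ∷ y ∷ _) = x ≡ y + 1
TopRun₂ _ = ⊥

TopRun₃ : List ℕ → Set
TopRun₃ (x ∷ y ∷ z ∷ _) = x ≡ y + 1 × y ≡ z + 1
TopRun₃ _ = ⊥

topRun₂? : Decidable TopRun₂
topRun₂? [] = no λ ()
topRun₂? (_ ∷ []) = no λ ()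
topRun₂? (x ∷ y ∷ _) = x ≟ y + 1

topRun₃? : Decidable TopRun₃
topRun₃? [] = no λ ()
topRun₃? (_ ∷ []) = no λ ()
topRun₃? (_ ∷ _ ∷ []) = no λ ()
topRun₃? (x ∷ y ∷ z ∷ _) = x ≟ y + 1 ×-dec y ≟ z + 1

DistinctNoOne : ℕ → List ℕ → Set
DistinctNoOne m l = IsDistinctPartition m l × All (2 ≤_) l

DistinctNoOneRun₂ : ℕ → List ℕ → Set
DistinctNoOneRun₂ m l = DistinctNoOne m l × TopRun₂ l

succ-head-decreasing : ∀ {x l} → Linked _>_ (x ∷ l) → Linked _>_ (suc x ∷ l)
succ-head-decreasing [-] = [-]
succ-head-decreasing (x>y ∷ l>) = m≤n⇒m≤1+n x>y ∷ l>

succ-head-¬TopRun₂ : ∀ {x l} → Linked _>_ (x ∷ l) → ¬ TopRun₂ (suc x ∷ l)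
succ-head-¬TopRun₂ [-] ()
succ-head-¬TopRun₂ {l = y ∷ _} (x>y ∷ _) 1+x≡y+1 = <-irrefl (sym (suc-injective (trans 1+x≡y+1 (+-comm y 1)))) x>y

m<1+n∧1+n≢m+1⇒m<n : ∀ {m n} → m < suc n → suc n ≢ m + 1 → m < n
m<1+n∧1+n≢m+1⇒m<n {m} m<1+n 1+n≢m+1 = ≤∧≢⇒< (≤-pred m<1+n) λ { refl → 1+n≢m+1 (+-comm 1 m) }

snoc-one-decreasing : ∀ l → Linked _>_ l → All (2 ≤_) l → Linked _>_ (l ++ [ 1 ])
snoc-one-decreasing [] _ _ = [-]
snoc-one-decreasing (x ∷ []) _ (x≥2 ∷ []) = x≥2 ∷ [-]
snoc-one-decreasing (x ∷ y ∷ l) (x>y ∷ l>) (_ ∷ l≥2) = x>y ∷ snoc-one-decreasing (y ∷ l) l> l≥2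

unsnoc-decreasing : ∀ l {z} → Linked _>_ (l ++ [ z ]) → Linked _>_ l
unsnoc-decreasing [] _ = []
unsnoc-decreasing (x ∷ []) _ = [-]
unsnoc-decreasing (x ∷ y ∷ l) (x>y ∷ l>) = x>y ∷ unsnoc-decreasing (y ∷ l) l>

dropLast : List ℕ → List ℕ
dropLast [] = []
dropLast (_ ∷ []) = []
dropLast (x ∷ y ∷ l) = x ∷ dropLast (y ∷ l)

dropLast-snoc : ∀ l z → dropLast (l ++ [ z ]) ≡ l
dropLast-snoc [] z = refl
dropLast-snoc (x ∷ []) z = refl
dropLast-snoc (x ∷ y ∷ l) z = cong (x ∷_) (dropLast-snoc (y ∷ l) z)

decreasing-withOne : ∀ l → Linked _>_ l → All (1 ≤_) l → ¬ All (2 ≤_) l →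
  ∃ λ l′ → l ≡ l′ ++ [ 1 ] × All (2 ≤_) l′
decreasing-withOne [] _ _ ¬l≥2 = ⊥-elim (¬l≥2 [])
decreasing-withOne (x ∷ []) _ (x≥1 ∷ []) ¬l≥2 with m≤n⇒m<n∨m≡n x≥1
... | inj₁ x≥2 = ⊥-elim (¬l≥2 (x≥2 ∷ []))
... | inj₂ refl = [] , refl , []
decreasing-withOne (x ∷ y ∷ l) (x>y ∷ l>) (_ ∷ l≥1@(y≥1 ∷ _)) ¬l≥2
  with decreasing-withOne (y ∷ l) l> l≥1 (λ l≥2 → ¬l≥2 (≤-trans (s≤s y≥1) x>y ∷ l≥2))
... | l′ , l≡ , l′≥2 = x ∷ l′ , cong (x ∷_) l≡ , ≤-trans (s≤s y≥1) x>y ∷ l′≥2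

Counted-withOne : ∀ {m a} → 1 ≤ m → Counted (DistinctNoOne (m ∸ 1)) a →
  Counted (λ l → IsDistinctPartition m l × ¬ All (2 ≤_) l) a
Counted-withOne {m} m≥1 = Counted-bijection (_++ [ 1 ]) dropLast snoc-one dropLast-valid (λ l _ → dropLast-snoc l 1) snoc-dropLast
  where
  snoc-one : ∀ l → DistinctNoOne (m ∸ 1) l → IsDistinctPartition m (l ++ [ 1 ]) × ¬ All (2 ≤_) (l ++ [ 1 ])
  snoc-one l ((Σl , _ , l>) , l≥2) =
    (trans (sum-++ l [ 1 ]) (trans (cong (_+ 1) Σl) (m∸n+n≡m m≥1)) ,
     All.++⁺ (All.map (≤-trans (s≤s z≤n)) l≥2) (s≤s z≤n ∷ []) , snoc-one-decreasing l l> l≥2) ,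
    λ l1≥2 → case All.++⁻ʳ l l1≥2 of λ { (s≤s () ∷ []) }
  dropLast-valid : ∀ l → IsDistinctPartition m l × ¬ All (2 ≤_) l → DistinctNoOne (m ∸ 1) (dropLast l)
  dropLast-valid l ((Σl , l≥1 , l>) , ¬l≥2) with decreasing-withOne l l> l≥1 ¬l≥2
  ... | l′ , refl , l′≥2 rewrite dropLast-snoc l′ 1 =
    (trans (sym (m+n∸n≡m (sum l′) 1)) (cong (_∸ 1) (trans (sym (sum-++ l′ [ 1 ])) Σl)) ,
     All.map (≤-trans (s≤s z≤n)) l′≥2 , unsnoc-decreasing l′ l>) ,
    l′≥2
  snoc-dropLast : ∀ l → IsDistinctPartition m l × ¬ All (2 ≤_) l → dropLast l ++ [ 1 ] ≡ l
  snoc-dropLast l ((_ , l≥1 , l>) , ¬l≥2) with decreasing-withOne l l> l≥1 ¬l≥2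
  ... | l′ , refl , _ = cong (_++ [ 1 ]) (dropLast-snoc l′ 1)

counts-by-part-one : ∀ {m c a a′} → 1 ≤ m → Counted (IsDistinctPartition m) c →
  Counted (DistinctNoOne m) a → Counted (DistinctNoOne (m ∸ 1)) a′ → c ≡ a + a′
counts-by-part-one m≥1 cq cq₂ cq₂′ with Counted-split (all? (2 ≤?_)) cq
... | _ , _ , cNoOne , cOne , Σ≡ =
  trans (sym Σ≡) (cong₂ _+_ (Counted-unique cNoOne cq₂) (Counted-unique cOne (Counted-withOne m≥1 cq₂′)))

succHead : List ℕ → List ℕ
succHead [] = []
succHead (x ∷ l) = suc x ∷ l

predHead : List ℕ → List ℕ
predHead [] = []
predHead (x ∷ l) = pred x ∷ l

Counted-¬TopRun₂ : ∀ {m a} → 3 ≤ m → Counted (DistinctNoOne (m ∸ 1)) a →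
  Counted (λ l → DistinctNoOne m l × ¬ TopRun₂ l) a
Counted-¬TopRun₂ {suc m} (s≤s m≥2) =
  Counted-bijection succHead predHead succ-valid pred-valid (λ { [] _ → refl ; (_ ∷ _) _ → refl }) succ-pred
  where
  succ-valid : ∀ l → DistinctNoOne m l → DistinctNoOne (suc m) (succHead l) × ¬ TopRun₂ (succHead l)
  succ-valid [] ((Σ[] , _) , _) = ⊥-elim (<⇒≢ (≤-trans (s≤s z≤n) m≥2) Σ[])
  succ-valid (x ∷ l) ((Σl , _ ∷ l≥1 , l>) , x≥2 ∷ l≥2) =
    ((cong suc Σl , s≤s z≤n ∷ l≥1 , succ-head-decreasing l>) , m≤n⇒m≤1+n x≥2 ∷ l≥2) , succ-head-¬TopRun₂ l>
  pred-valid : ∀ l → DistinctNoOne (suc m) l × ¬ TopRun₂ l → DistinctNoOne m (predHead l)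
  pred-valid [] (((() , _) , _) , _)
  pred-valid (zero ∷ _) (((_ , () ∷ _ , _) , _) , _)
  pred-valid (suc x ∷ []) (((Σl , _) , _) , _) = (suc-injective Σl , ≤-trans (s≤s z≤n) x≥2 ∷ [] , [-]) , x≥2 ∷ []
    where
    x≥2 : 2 ≤ x
    x≥2 = subst (2 ≤_) (trans (sym (suc-injective Σl)) (+-identityʳ x)) m≥2
  pred-valid (suc x ∷ y ∷ l) (((Σl , _ ∷ l≥1 , 1+x>y ∷ l>) , _ ∷ l≥2@(y≥2 ∷ _)) , ¬run) =
    (suc-injective Σl , ≤-trans (s≤s z≤n) x>y ∷ l≥1 , x>y ∷ l>) , ≤-trans y≥2 (<⇒≤ x>y) ∷ l≥2
    where
    x>y = m<1+n∧1+n≢m+1⇒m<n 1+x>y ¬run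
  succ-pred : ∀ l → DistinctNoOne (suc m) l × ¬ TopRun₂ l → succHead (predHead l) ≡ l
  succ-pred [] _ = refl
  succ-pred (zero ∷ _) (((_ , () ∷ _ , _) , _) , _)
  succ-pred (suc _ ∷ _) _ = refl

counts-by-top-pair : ∀ {m a a′ r} → 3 ≤ m → Counted (DistinctNoOne m) a →
  Counted (DistinctNoOne (m ∸ 1)) a′ → Counted (DistinctNoOneRun₂ m) r → a ≡ r + a′
counts-by-top-pair m≥3 cq₂ cq₂′ cr with Counted-split topRun₂? cq₂
... | _ , _ , cRun , cNoRun , Σ≡ =
  trans (sym Σ≡) (cong₂ _+_ (Counted-unique cRun cr) (Counted-unique cNoRun (Counted-¬TopRun₂ m≥3 cq₂′)))

DistinctNoOneRun₃ : ℕ → List ℕ → Set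
DistinctNoOneRun₃ m l = DistinctNoOne m l × TopRun₃ l

TopRun₃⇒TopRun₂-tail : ∀ {x} l → TopRun₃ (x ∷ l) → TopRun₂ l
TopRun₃⇒TopRun₂-tail (_ ∷ _ ∷ _) (_ , run) = run

TopRun₃⇒TopRun₂ : ∀ l → TopRun₃ l → TopRun₂ l
TopRun₃⇒TopRun₂ (_ ∷ _ ∷ _ ∷ _) (run , _) = run

succTop₂ : List ℕ → List ℕ
succTop₂ (x ∷ y ∷ l) = suc x ∷ suc y ∷ l
succTop₂ l = l

predTop₂ : List ℕ → List ℕ
predTop₂ (x ∷ y ∷ l) = pred x ∷ pred y ∷ l
predTop₂ l = l

y≥2-from-sum : ∀ {x y m} → x ≡ y + 1 → x + (y + 0) ≡ m → 4 ≤ m → 2 ≤ y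
y≥2-from-sum {y = suc (suc _)} _ _ _ = s≤s (s≤s z≤n)
y≥2-from-sum {y = 0} refl refl (s≤s ())
y≥2-from-sum {y = 1} refl refl (s≤s (s≤s (s≤s ())))

Counted-¬TopRun₃ : ∀ {m r} → 6 ≤ m → Counted (DistinctNoOneRun₂ (m ∸ 2)) r →
  Counted (λ l → DistinctNoOneRun₂ m l × ¬ TopRun₃ l) r
Counted-¬TopRun₃ {suc (suc m)} (s≤s (s≤s m≥4)) =
  Counted-bijection succTop₂ predTop₂ succ-valid pred-valid pred-succ succ-pred
  where
  succ-valid : ∀ l → DistinctNoOneRun₂ m l → DistinctNoOneRun₂ (suc (suc m)) (succTop₂ l) × ¬ TopRun₃ (succTop₂ l)
  succ-valid (x ∷ y ∷ l) (((Σl , _ ∷ _ ∷ l≥1 , x>y ∷ l>) , x≥2 ∷ y≥2 ∷ l≥2) , x≡y+1) =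
    (((cong suc (trans (+-suc x (y + sum l)) (cong suc Σl)) , s≤s z≤n ∷ s≤s z≤n ∷ l≥1 ,
       s≤s x>y ∷ succ-head-decreasing l>) ,
      m≤n⇒m≤1+n x≥2 ∷ m≤n⇒m≤1+n y≥2 ∷ l≥2) , cong suc x≡y+1) ,
    λ run → succ-head-¬TopRun₂ l> (TopRun₃⇒TopRun₂-tail (suc y ∷ l) run)
  pred-valid : ∀ l → DistinctNoOneRun₂ (suc (suc m)) l × ¬ TopRun₃ l → DistinctNoOneRun₂ m (predTop₂ l)
  pred-valid (zero ∷ _ ∷ _) ((((_ , () ∷ _ , _) , _) , _) , _)
  pred-valid (suc _ ∷ zero ∷ _) ((((_ , _ ∷ () ∷ _ , _) , _) , _) , _)
  pred-valid (suc x ∷ suc y ∷ l) ((((Σl , _ ∷ _ ∷ l≥1 , _ ∷ l>) , _ ∷ _ ∷ l≥2) , 1+x≡2+y) , ¬run) =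
    ((Σl′ , ≤-trans (s≤s z≤n) x≥2 ∷ ≤-trans (s≤s z≤n) y≥2 ∷ l≥1 , x>y ∷ proj₂ (y-tail l l> l≥2 ¬run Σl′)) ,
      x≥2 ∷ y≥2 ∷ l≥2) ,
    x≡y+1
    where
    x≡y+1 : x ≡ y + 1
    x≡y+1 = suc-injective 1+x≡2+y
    x>y : x > y
    x>y = subst (y <_) (sym x≡y+1) (m<m+n y (s≤s z≤n))
    Σl′ : x + (y + sum l) ≡ m
    Σl′ = suc-injective (trans (sym (+-suc x (y + sum l))) (suc-injective Σl))
    y-tail : ∀ l → Linked _>_ (suc y ∷ l) → All (2 ≤_) l → ¬ TopRun₃ (suc x ∷ suc y ∷ l) →
      x + (y + sum l) ≡ m → 2 ≤ y × Linked _>_ (y ∷ l)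
    y-tail [] _ _ _ Σ[x,y] = y≥2-from-sum x≡y+1 Σ[x,y] m≥4 , [-]
    y-tail (z ∷ _) (1+y>z ∷ l>′) (z≥2 ∷ _) ¬run′ _ = ≤-trans z≥2 (<⇒≤ y>z) , y>z ∷ l>′
      where
      y>z = m<1+n∧1+n≢m+1⇒m<n 1+y>z (λ run → ¬run′ (1+x≡2+y , run))
    y≥2 = proj₁ (y-tail l l> l≥2 ¬run Σl′)
    x≥2 : 2 ≤ x
    x≥2 = ≤-trans y≥2 (<⇒≤ x>y)
  pred-succ : ∀ l → DistinctNoOneRun₂ m l → predTop₂ (succTop₂ l) ≡ l
  pred-succ (_ ∷ _ ∷ _) _ = refl
  succ-pred : ∀ l → DistinctNoOneRun₂ (suc (suc m)) l × ¬ TopRun₃ l → succTop₂ (predTop₂ l) ≡ l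
  succ-pred (zero ∷ _ ∷ _) ((((_ , () ∷ _ , _) , _) , _) , _)
  succ-pred (suc _ ∷ zero ∷ _) ((((_ , _ ∷ () ∷ _ , _) , _) , _) , _)
  succ-pred (suc _ ∷ suc _ ∷ _) _ = refl

counts-by-top-triple : ∀ {m r r′ b} → 6 ≤ m → Counted (DistinctNoOneRun₂ m) r →
  Counted (DistinctNoOneRun₂ (m ∸ 2)) r′ → Counted (DistinctNoOneRun₃ m) b → r ≡ b + r′
counts-by-top-triple {m} m≥6 cr cr′ cb with Counted-split topRun₃? cr
... | _ , _ , cRun , cNoRun , Σ≡ =
  trans (sym Σ≡) (cong₂ _+_ (Counted-unique (Counted-cong run₃ cRun) cb)
                            (Counted-unique cNoRun (Counted-¬TopRun₃ m≥6 cr′)))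
  where
  run₃ : ∀ l → (DistinctNoOneRun₂ m l × TopRun₃ l) ⇔ DistinctNoOneRun₃ m l
  run₃ l = mk⇔ (λ ((d , _) , run) → d , run) (λ (d , run) → (d , TopRun₃⇒TopRun₂ l run) , run)

Counted-DistinctNoOne : ∀ m → ∃ (Counted (DistinctNoOne m))
Counted-DistinctNoOne m = Counted-filter (all? (2 ≤?_)) (proj₂ (Counted-IsDistinctPartition m))

Counted-DistinctNoOneRun₂ : ∀ m → ∃ (Counted (DistinctNoOneRun₂ m))
Counted-DistinctNoOneRun₂ m = Counted-filter topRun₂? (proj₂ (Counted-DistinctNoOne m))

Counted-DistinctNoOneRun₃ : ∀ m → ∃ (Counted (DistinctNoOneRun₃ m))
Counted-DistinctNoOneRun₃ m = Counted-filter topRun₃? (proj₂ (Counted-DistinctNoOne m))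

butterflies-second-difference : ∀ {n b c d e} → 6 ≤ n → Counted (DistinctNoOneRun₃ n) b →
  Counted (IsDistinctPartition n) c → Counted (IsDistinctPartition (n ∸ 1)) d → Counted (IsDistinctPartition (n ∸ 2)) e →
  b + 2 * d ≡ c + e
butterflies-second-difference {n@(suc (suc (suc (suc (suc (suc _))))))} n≥6@(s≤s (s≤s (s≤s (s≤s (s≤s (s≤s _))))))
                              cb cq₀ cq₁ cq₂ =
  arithmetic
    (counts-by-part-one (s≤s z≤n) cq₀ (cq₂′ n) (cq₂′ (n ∸ 1)))
    (counts-by-part-one (s≤s z≤n) cq₁ (cq₂′ (n ∸ 1)) (cq₂′ (n ∸ 2)))
    (counts-by-part-one (s≤s z≤n) cq₂ (cq₂′ (n ∸ 2)) (cq₂′ (n ∸ 3)))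
    (counts-by-top-pair (s≤s (s≤s (s≤s z≤n))) (cq₂′ n) (cq₂′ (n ∸ 1)) (cr n))
    (counts-by-top-pair (s≤s (s≤s (s≤s z≤n))) (cq₂′ (n ∸ 2)) (cq₂′ (n ∸ 3)) (cr (n ∸ 2)))
    (counts-by-top-triple n≥6 (cr n) (cr (n ∸ 2)) cb)
  where
  cq₂′ : ∀ m → Counted (DistinctNoOne m) (proj₁ (Counted-DistinctNoOne m))
  cq₂′ m = proj₂ (Counted-DistinctNoOne m)
  cr : ∀ m → Counted (DistinctNoOneRun₂ m) (proj₁ (Counted-DistinctNoOneRun₂ m))
  cr m = proj₂ (Counted-DistinctNoOneRun₂ m)
  arithmetic : ∀ {b c d e a₀ a₁ a₂ a₃ r₀ r₂} → c ≡ a₀ + a₁ → d ≡ a₁ + a₂ → e ≡ a₂ + a₃ →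
    a₀ ≡ r₀ + a₁ → a₂ ≡ r₂ + a₃ → r₀ ≡ b + r₂ → b + 2 * d ≡ c + e
  arithmetic {b} {a₁ = a₁} {a₃ = a₃} {r₂ = r₂} refl refl refl refl refl refl = solve b a₁ a₃ r₂
    where
    solve : ∀ b a₁ a₃ r₂ → b + 2 * (a₁ + (r₂ + a₃)) ≡ b + r₂ + a₁ + a₁ + (r₂ + a₃ + a₃)
    solve = solve-∀

-- Parity, odd parts and bases

parity : ∀ q → Even q ⊎ Odd q
parity q with q % 2 | m%n<n q 2
... | 0 | _ = inj₁ refl
... | 1 | _ = inj₂ refl
... | suc (suc _) | s≤s (s≤s ())

Odd⇒¬Even : ∀ {q} → Odd q → ¬ Even q
Odd⇒¬Even odd even with trans (sym odd) even
... | ()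

Odd-view : ∀ {q} → Odd q → ∃ λ m → q ≡ 1 + m * 2
Odd-view {q} odd = q / 2 , trans (m≡m%n+[m/n]*n q 2) (cong (_+ q / 2 * 2) odd)

Even-view : ∀ {q} → Even q → ∃ λ m → q ≡ m * 2
Even-view {q} even = q / 2 , trans (m≡m%n+[m/n]*n q 2) (cong (_+ q / 2 * 2) even)

Even-intro : ∀ m → Even (m * 2)
Even-intro m = m*n%n≡0 m 2

Odd-+-even : ∀ {q} t → Odd q → Odd (q + t * 2)
Odd-+-even {q} t odd = trans ([m+kn]%n≡m%n q t 2) odd

Odd⇒Even-suc : ∀ {q} → Odd q → Even (q + 1)
Odd⇒Even-suc {q} odd = trans (%-distribˡ-+ q 1 2) (cong (λ r → (r + 1) % 2) odd)

Even⇒Odd-suc : ∀ {q} → Even q → Odd (q + 1)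
Even⇒Odd-suc {q} even = trans (%-distribˡ-+ q 1 2) (cong (λ r → (r + 1) % 2) even)

¬Even⇒Odd : ∀ q → ¬ Even q → Odd q
¬Even⇒Odd q ¬even with parity q
... | inj₁ even = ⊥-elim (¬even even)
... | inj₂ odd = odd

Even-suc⇒Odd : ∀ {q} → Even (q + 1) → Odd q
Even-suc⇒Odd {q} even with parity q
... | inj₁ q-even = ⊥-elim (Odd⇒¬Even {q + 1} (Even⇒Odd-suc {q} q-even) even)
... | inj₂ q-odd = q-odd

Odd-suc⇒Even : ∀ {q} → Odd (q + 1) → Even q
Odd-suc⇒Even {q} odd with parity q
... | inj₁ q-even = q-even
... | inj₂ q-odd = ⊥-elim (Odd⇒¬Even {q + 1} odd (Odd⇒Even-suc {q} q-odd))

Odd-difference : ∀ {a b} → Odd a → Odd b → b ≤ a → a ≡ b + (a ∸ b) / 2 * 2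
Odd-difference {a} {b} a-odd b-odd b≤a with Odd-view {a} a-odd | Odd-view {b} b-odd
... | m , refl | m′ , refl = cong suc (begin
  m * 2                     ≡⟨ cong (_* 2) (m+[n∸m]≡n m′≤m) ⟨
  (m′ + (m ∸ m′)) * 2       ≡⟨ *-distribʳ-+ 2 m′ (m ∸ m′) ⟩
  m′ * 2 + (m ∸ m′) * 2     ≡⟨ cong (m′ * 2 +_) (cong (_* 2) (m*n/n≡m (m ∸ m′) 2)) ⟨
  m′ * 2 + (m ∸ m′) * 2 / 2 * 2 ≡⟨ cong (λ d → m′ * 2 + d / 2 * 2) (*-distribʳ-∸ 2 m m′) ⟩
  m′ * 2 + (m * 2 ∸ m′ * 2) / 2 * 2 ∎)
  where
  open ≡-Reasoning
  m′≤m : m′ ≤ m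
  m′≤m = *-cancelʳ-≤ m′ m 2 (≤-pred b≤a)

OddGe3-split : ∀ {k} → OddGe3 k → k ≡ 3 ⊎ 5 ≤ k
OddGe3-split {k} (odd , k≥3) with Odd-view {k} odd
OddGe3-split (_ , s≤s ()) | 0 , refl
OddGe3-split _ | 1 , refl = inj₁ refl
OddGe3-split _ | suc (suc _) , refl = inj₂ (s≤s (s≤s (s≤s (s≤s (s≤s z≤n)))))

Odd⇒≥3 : ∀ {q} → Odd q → 2 ≤ q → 3 ≤ q
Odd⇒≥3 {suc (suc (suc _))} _ _ = s≤s (s≤s (s≤s z≤n))
Odd⇒≥3 {2} () _
Odd⇒≥3 {1} _ (s≤s ())

Even-≢2⇒≥4 : ∀ {P} → Even P → 2 ≤ P → P ≢ 2 → 4 ≤ P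
Even-≢2⇒≥4 {suc (suc (suc (suc _)))} _ _ _ = s≤s (s≤s (s≤s (s≤s z≤n)))
Even-≢2⇒≥4 {2} _ _ P≢2 = ⊥-elim (P≢2 refl)
Even-≢2⇒≥4 {3} () _ _

OddTimesPow2 : ℕ → Set
OddTimesPow2 x = Σ (ℕ × ℕ) λ (o , j) → 1 ≤ x → Odd o × x ≡ o * 2 ^ j

oddTimesPow2 : ∀ x → OddTimesPow2 x
oddTimesPow2 = <-rec OddTimesPow2 step
  where
  step : ∀ x → (∀ {y} → y < x → OddTimesPow2 y) → OddTimesPow2 x
  step zero _ = (0 , 0) , λ ()
  step x@(suc _) rec with parity x
  ... | inj₂ x-odd = (x , 0) , λ _ → x-odd , sym (*-identityʳ x)
  ... | inj₁ x-even = (o , suc j) , λ _ → o-odd , x≡o*2^[1+j]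
    where
    x≡h*2 : x ≡ x / 2 * 2
    x≡h*2 = proj₂ (Even-view {x} x-even)
    h≥1 : 1 ≤ x / 2
    h≥1 with x / 2 | x≡h*2
    ... | suc _ | _ = s≤s z≤n
    halved = rec (m/n<m x 2 (s≤s (s≤s z≤n)))
    o = proj₁ (proj₁ halved)
    j = proj₂ (proj₁ halved)
    o-odd = proj₁ (proj₂ halved h≥1)
    x≡o*2^[1+j] : x ≡ o * 2 ^ suc j
    x≡o*2^[1+j] = begin
      x               ≡⟨ x≡h*2 ⟩
      x / 2 * 2       ≡⟨ cong (_* 2) (proj₂ (proj₂ halved h≥1)) ⟩
      o * 2 ^ j * 2   ≡⟨ *-assoc o (2 ^ j) 2 ⟩
      o * (2 ^ j * 2) ≡⟨ cong (o *_) (*-comm (2 ^ j) 2) ⟩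
      o * 2 ^ suc j   ∎
      where open ≡-Reasoning

Base : ℕ → Set
Base k = k ≡ 2 ⊎ OddGe3 k

Base⇒≥2 : ∀ {k} → Base k → 2 ≤ k
Base⇒≥2 (inj₁ refl) = ≤-refl
Base⇒≥2 (inj₂ (_ , k≥3)) = ≤-trans (n≤1+n 2) k≥3

Base⇒≥1 : ∀ {k} → Base k → 1 ≤ k
Base⇒≥1 k-base = ≤-trans (s≤s z≤n) (Base⇒≥2 k-base)

-- A power of two 2 ^ j is written 2 · 2 ^ (j - 1), so that every base is 2 or odd ≥ 3.
toBase : ℕ × ℕ → ℕ × ℕ
toBase (o , j) with o ≟ 1
... | yes _ = 2 , j ∸ 1
... | no _ = o , j

toBase-spec : ∀ {x} o j → Odd o → x ≡ o * 2 ^ j → 2 ≤ x →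
  Base (proj₁ (toBase (o , j))) × proj₁ (toBase (o , j)) * 2 ^ proj₂ (toBase (o , j)) ≡ x
toBase-spec o j o-odd x≡ x≥2 with o ≟ 1
toBase-spec _ zero _ refl (s≤s ()) | yes refl
toBase-spec _ (suc j) _ refl _ | yes refl = inj₁ refl , sym (*-identityˡ (2 ^ suc j))
toBase-spec o j o-odd refl x≥2 | no o≢1 = inj₂ (o-odd , o≥3) , refl
  where
  o≥3 : 3 ≤ o
  o≥3 with Odd-view {o} o-odd
  ... | 0 , refl = ⊥-elim (o≢1 refl)
  ... | suc _ , refl = s≤s (s≤s (s≤s z≤n))

-- Kept abstract: unfolding the well-founded recursion behind oddTimesPow2 makes type checking very slow.
abstract
  base exponent : ℕ → ℕ
  base x = proj₁ (toBase (proj₁ (oddTimesPow2 x)))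
  exponent x = proj₂ (toBase (proj₁ (oddTimesPow2 x)))

  base-spec : ∀ x → 2 ≤ x → Base (base x) × base x * 2 ^ exponent x ≡ x
  base-spec x x≥2 with oddTimesPow2 x
  ... | (o , j) , spec with spec (≤-trans (s≤s z≤n) x≥2)
  ...   | o-odd , x≡ = toBase-spec o j o-odd x≡ x≥2

m*2^[1+n]≡m*2^n*2 : ∀ o a → o * 2 ^ suc a ≡ o * 2 ^ a * 2
m*2^[1+n]≡m*2^n*2 o a = trans (cong (o *_) (*-comm 2 (2 ^ a))) (sym (*-assoc o (2 ^ a) 2))

Even-*2^[1+n] : ∀ o a → Even (o * 2 ^ suc a)
Even-*2^[1+n] o a = subst Even (sym (m*2^[1+n]≡m*2^n*2 o a)) (Even-intro (o * 2 ^ a))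

odd-part-unique : ∀ {o o′} a b → Odd o → Odd o′ → o * 2 ^ a ≡ o′ * 2 ^ b → o ≡ o′
odd-part-unique {o} {o′} zero zero _ _ eq = trans (sym (*-identityʳ o)) (trans eq (*-identityʳ o′))
odd-part-unique {o} {o′} zero (suc b) o-odd _ eq =
  ⊥-elim (Odd⇒¬Even {o} o-odd (subst Even (sym (trans (sym (*-identityʳ o)) eq)) (Even-*2^[1+n] o′ b)))
odd-part-unique {o} {o′} (suc a) zero _ o′-odd eq =
  ⊥-elim (Odd⇒¬Even {o′} o′-odd (subst Even (trans eq (*-identityʳ o′)) (Even-*2^[1+n] o a)))
odd-part-unique {o} {o′} (suc a) (suc b) o-odd o′-odd eq = odd-part-unique a b o-odd o′-odd
  (*-cancelʳ-≡ (o * 2 ^ a) (o′ * 2 ^ b) 2 (trans (sym (m*2^[1+n]≡m*2^n*2 o a)) (trans eq (m*2^[1+n]≡m*2^n*2 o′ b))))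

base-unique : ∀ {k k′} a b → Base k → Base k′ → k * 2 ^ a ≡ k′ * 2 ^ b → k ≡ k′
base-unique a b (inj₁ refl) (inj₁ refl) _ = refl
base-unique a b (inj₂ (k-odd , _)) (inj₂ (k′-odd , _)) eq = odd-part-unique a b k-odd k′-odd eq
base-unique {k′ = k′} a b (inj₁ refl) (inj₂ (k′-odd , k′≥3)) eq
  with odd-part-unique {1} {k′} (suc a) b refl k′-odd (trans (*-identityˡ (2 ^ suc a)) eq)
... | refl = ⊥-elim (<⇒≱ k′≥3 (s≤s z≤n))
base-unique {k} a b (inj₂ (k-odd , k≥3)) (inj₁ refl) eq
  with odd-part-unique {1} {k} (suc b) a refl k-odd (trans (*-identityˡ (2 ^ suc b)) (sym eq))
... | refl = ⊥-elim (<⇒≱ k≥3 (s≤s z≤n))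

-- The power condition

pow2-floor : ∀ u → 0 < u → ∃ λ a → 2 ^ a ≤ u × u < 2 ^ suc a
pow2-floor (suc zero) _ = 0 , ≤-refl , s≤s (s≤s z≤n)
pow2-floor (suc (suc u)) _ with pow2-floor (suc u) (s≤s z≤n)
... | a , 2^a≤u , u<2^[1+a] with m≤n⇒m<n∨m≡n u<2^[1+a]
...   | inj₁ 1+u<2^[1+a] = a , m≤n⇒m≤1+n 2^a≤u , 1+u<2^[1+a]
...   | inj₂ 2+u≡2^[1+a] = suc a , ≤-reflexive (sym 2+u≡2^[1+a]) ,
        subst (_< 2 ^ suc (suc a)) (sym 2+u≡2^[1+a]) (^-monoʳ-< 2 (s≤s (s≤s z≤n)) (n<1+n (suc a)))

2^-cancel-≤ : ∀ {a b} → 2 ^ a ≤ 2 ^ b → a ≤ b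
2^-cancel-≤ {a} {b} 2^a≤2^b with a ≤? b
... | yes a≤b = a≤b
... | no a≰b = ⊥-elim (<⇒≱ (^-monoʳ-< 2 (s≤s (s≤s z≤n)) (≰⇒> a≰b)) 2^a≤2^b)

2^-cancel-< : ∀ {a b} → 2 ^ a < 2 ^ b → a < b
2^-cancel-< {a} {b} 2^a<2^b with a <? b
... | yes a<b = a<b
... | no a≮b = ⊥-elim (<⇒≱ 2^a<2^b (^-monoʳ-≤ 2 (≮⇒≥ a≮b)))

PowCond-zero : ∀ {k B} → PowCond k 0 B
PowCond-zero ()

module _ {k u : ℕ} where

  PowCond-mono : ∀ {B B′} → B ≤ B′ → PowCond k u B → PowCond k u B′
  PowCond-mono B≤B′ pc u>0 a 2^a≤u u<2^[1+a] = ≤-trans (pc u>0 a 2^a≤u u<2^[1+a]) B≤B′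

  PowCond⇒≤ : ∀ {B j} → PowCond k u B → 2 ^ j ≤ u → k * 2 ^ j ≤ B
  PowCond⇒≤ {j = j} pc 2^j≤u with pow2-floor u (≤-trans (m^n>0 2 j) 2^j≤u)
  ... | a , 2^a≤u , u<2^[1+a] =
    ≤-trans (*-monoʳ-≤ k (^-monoʳ-≤ 2 {j} {a} j≤a)) (pc (≤-trans (m^n>0 2 j) 2^j≤u) a 2^a≤u u<2^[1+a])
    where
    j≤a = ≤-pred (2^-cancel-< {j} {suc a} (≤-<-trans 2^j≤u u<2^[1+a]))

  PowCond⇒base≤ : ∀ {B} → PowCond k u B → 0 < u → k ≤ B
  PowCond⇒base≤ pc u>0 = subst (_≤ _) (*-identityʳ k) (PowCond⇒≤ {j = 0} pc u>0)

  PowCond-tight⇒< : ∀ {j} → 1 ≤ k → PowCond k u (k * 2 ^ j) → 2 ^ j ≤ u → u < 2 ^ suc j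
  PowCond-tight⇒< {j} k≥1 pc 2^j≤u with pow2-floor u (≤-trans (m^n>0 2 j) 2^j≤u)
  ... | a , 2^a≤u , u<2^[1+a] =
    <-≤-trans u<2^[1+a] (^-monoʳ-≤ 2 {suc a} {suc j} (s≤s (2^-cancel-≤ {a} {j} (*-cancelˡ-≤ k {{>-nonZero k≥1}} k*2^a≤k*2^j))))
    where
    k*2^a≤k*2^j = pc (≤-trans (m^n>0 2 j) 2^j≤u) a 2^a≤u u<2^[1+a]

  PowCond-< : ∀ {j N} → 1 ≤ k → u < 2 ^ j → k * 2 ^ j ≤ suc N → PowCond k u N
  PowCond-< {j} {N} k≥1 u<2^j k*2^j≤1+N _ a 2^a≤u _ =
    ≤-pred (<-≤-trans (*-monoʳ-< k {{>-nonZero k≥1}} (^-monoʳ-< 2 (s≤s (s≤s z≤n)) {a} {j} a<j)) k*2^j≤1+N)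
    where
    a<j = 2^-cancel-< {a} {j} (≤-<-trans 2^a≤u u<2^j)

  PowCond-pred : ∀ {N} → PowCond k u (suc N) → (∀ a → k * 2 ^ a ≢ suc N) → PowCond k u N
  PowCond-pred pc never u>0 a 2^a≤u u<2^[1+a] with m≤n⇒m<n∨m≡n (pc u>0 a 2^a≤u u<2^[1+a])
  ... | inj₁ k*2^a<1+N = ≤-pred k*2^a<1+N
  ... | inj₂ k*2^a≡1+N = ⊥-elim (never a k*2^a≡1+N)

PowCond-+ : ∀ {k u j} → u < 2 ^ j → PowCond k (2 ^ j + u) (k * 2 ^ j)
PowCond-+ {k} {u} {j} u<2^j _ a 2^a≤ 2^j+u<2^[1+a] = *-monoʳ-≤ k (^-monoʳ-≤ 2 {a} {j} a≤j)
  where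
  2^j+u<2^[1+j] : 2 ^ j + u < 2 ^ suc j
  2^j+u<2^[1+j] = subst (2 ^ j + u <_) (cong (2 ^ j +_) (sym (+-identityʳ (2 ^ j)))) (+-monoʳ-< (2 ^ j) u<2^j)
  a≤j = ≤-pred (2^-cancel-< {a} {suc j} (≤-<-trans 2^a≤ 2^j+u<2^[1+j]))

-- Multisets as non-increasing lists

occ-here : ∀ k xs → occ k (k ∷ xs) ≡ suc (occ k xs)
occ-here k xs = cong length (filter-accept (_≟ k) {k} {xs} refl)

occ-there : ∀ {k x} xs → x ≢ k → occ k (x ∷ xs) ≡ occ k xs
occ-there {k} {x} xs x≢k = cong length (filter-reject (_≟ k) {x} {xs} x≢k)

occ>0⇒∈ : ∀ {k} xs → 1 ≤ occ k xs → k ∈ xs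
occ>0⇒∈ {k} (x ∷ xs) occ>0 with x ≟ k
... | yes refl = here refl
... | no x≢k = there (occ>0⇒∈ xs (subst (1 ≤_) (occ-there xs x≢k) occ>0))

NonIncreasing : List ℕ → Set
NonIncreasing = AllPairs _≥_

insert : ℕ → List ℕ → List ℕ
insert k [] = [ k ]
insert k (y ∷ M) with y ≤? k
... | yes _ = k ∷ y ∷ M
... | no _ = y ∷ insert k M

insertMany : ℕ → ℕ → List ℕ → List ℕ
insertMany zero k M = M
insertMany (suc c) k M = insert k (insertMany c k M)

remove : ℕ → List ℕ → List ℕ
remove k [] = []
remove k (y ∷ M) with y ≟ k
... | yes _ = M
... | no _ = y ∷ remove k M

removeMany : ℕ → ℕ → List ℕ → List ℕ
removeMany zero k M = M
removeMany (suc c) k M = removeMany c k (remove k M)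

occ-insert-same : ∀ k M → occ k (insert k M) ≡ suc (occ k M)
occ-insert-same k [] = occ-here k []
occ-insert-same k (y ∷ M) with y ≤? k
... | yes _ = occ-here k (y ∷ M)
... | no y≰k with y ≟ k
...   | yes refl = ⊥-elim (y≰k ≤-refl)
...   | no y≢k = trans (occ-there (insert k M) y≢k) (trans (occ-insert-same k M) (cong suc (sym (occ-there M y≢k))))

occ-insert-other : ∀ k q M → q ≢ k → occ q (insert k M) ≡ occ q M
occ-insert-other k q [] q≢k = occ-there [] (q≢k ∘ sym)
occ-insert-other k q (y ∷ M) q≢k with y ≤? k
... | yes _ = occ-there (y ∷ M) (q≢k ∘ sym)
... | no _ with y ≟ q
...   | yes refl = trans (occ-here y (insert k M)) (trans (cong suc (occ-insert-other k y M q≢k)) (sym (occ-here y M)))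
...   | no y≢q = trans (occ-there (insert k M) y≢q) (trans (occ-insert-other k q M q≢k) (sym (occ-there M y≢q)))

occ-insertMany-same : ∀ c k M → occ k (insertMany c k M) ≡ c + occ k M
occ-insertMany-same zero k M = refl
occ-insertMany-same (suc c) k M = trans (occ-insert-same k (insertMany c k M)) (cong suc (occ-insertMany-same c k M))

occ-insertMany-other : ∀ c k q M → q ≢ k → occ q (insertMany c k M) ≡ occ q M
occ-insertMany-other zero k q M _ = refl
occ-insertMany-other (suc c) k q M q≢k = trans (occ-insert-other k q (insertMany c k M) q≢k) (occ-insertMany-other c k q M q≢k)

occ-remove-same : ∀ k M → occ k (remove k M) ≡ occ k M ∸ 1
occ-remove-same k [] = refl
occ-remove-same k (y ∷ M) with y ≟ k
... | yes refl = sym (cong (_∸ 1) (occ-here y M))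
... | no y≢k = trans (occ-there (remove k M) y≢k) (trans (occ-remove-same k M) (cong (_∸ 1) (sym (occ-there M y≢k))))

occ-remove-other : ∀ k q M → q ≢ k → occ q (remove k M) ≡ occ q M
occ-remove-other k q [] _ = refl
occ-remove-other k q (y ∷ M) q≢k with y ≟ k
... | yes refl = sym (occ-there M (q≢k ∘ sym))
... | no _ with y ≟ q
...   | yes refl = trans (occ-here y (remove k M)) (trans (cong suc (occ-remove-other k y M q≢k)) (sym (occ-here y M)))
...   | no y≢q = trans (occ-there (remove k M) y≢q) (trans (occ-remove-other k q M q≢k) (sym (occ-there M y≢q)))

occ-removeMany-same : ∀ c k M → occ k (removeMany c k M) ≡ occ k M ∸ c
occ-removeMany-same zero k M = refl
occ-removeMany-same (suc c) k M =
  trans (occ-removeMany-same c k (remove k M)) (trans (cong (_∸ c) (occ-remove-same k M)) (∸-+-assoc (occ k M) 1 c))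

occ-removeMany-other : ∀ c k q M → q ≢ k → occ q (removeMany c k M) ≡ occ q M
occ-removeMany-other zero k q M _ = refl
occ-removeMany-other (suc c) k q M q≢k = trans (occ-removeMany-other c k q (remove k M) q≢k) (occ-remove-other k q M q≢k)

remove-insert : ∀ k M → remove k (insert k M) ≡ M
remove-insert k [] with k ≟ k
... | yes _ = refl
... | no k≢k = ⊥-elim (k≢k refl)
remove-insert k (y ∷ M) with y ≤? k
... | yes _ with k ≟ k
...   | yes _ = refl
...   | no k≢k = ⊥-elim (k≢k refl)
remove-insert k (y ∷ M) | no y≰k with y ≟ k
...   | yes refl = ⊥-elim (y≰k ≤-refl)
...   | no _ = cong (y ∷_) (remove-insert k M)

removeMany-insertMany : ∀ c k M → removeMany c k (insertMany c k M) ≡ M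
removeMany-insertMany zero k M = refl
removeMany-insertMany (suc c) k M =
  trans (cong (removeMany c k) (remove-insert k (insertMany c k M))) (removeMany-insertMany c k M)

insert-head : ∀ k M → All (_≤ k) M → insert k M ≡ k ∷ M
insert-head k [] _ = refl
insert-head k (y ∷ M) (y≤k ∷ _) with y ≤? k
... | yes _ = refl
... | no y≰k = ⊥-elim (y≰k y≤k)

insert-remove : ∀ k M → NonIncreasing M → 1 ≤ occ k M → insert k (remove k M) ≡ M
insert-remove k (y ∷ M) (M≤y ∷ M↓) occ>0 with y ≟ k
... | yes refl = insert-head y M M≤y
... | no y≢k with y ≤? k
...   | yes y≤k = ⊥-elim (y≢k (≤-antisym y≤k (All.lookup M≤y (occ>0⇒∈ M (subst (1 ≤_) (occ-there M y≢k) occ>0)))))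
...   | no _ = cong (y ∷_) (insert-remove k M M↓ (subst (1 ≤_) (occ-there M y≢k) occ>0))

module _ {P : ℕ → Set} where

  All-remove : ∀ k M → All P M → All P (remove k M)
  All-remove k [] [] = []
  All-remove k (y ∷ M) (Py ∷ PM) with y ≟ k
  ... | yes _ = PM
  ... | no _ = Py ∷ All-remove k M PM

  All-removeMany : ∀ c k M → All P M → All P (removeMany c k M)
  All-removeMany zero k M PM = PM
  All-removeMany (suc c) k M PM = All-removeMany c k (remove k M) (All-remove k M PM)

  All-insert : ∀ k M → P k → All P M → All P (insert k M)
  All-insert k [] Pk [] = Pk ∷ []
  All-insert k (y ∷ M) Pk (Py ∷ PM) with y ≤? k
  ... | yes _ = Pk ∷ Py ∷ PM
  ... | no _ = Py ∷ All-insert k M Pk PM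

  All-insertMany : ∀ c k M → P k → All P M → All P (insertMany c k M)
  All-insertMany zero k M Pk PM = PM
  All-insertMany (suc c) k M Pk PM = All-insert k (insertMany c k M) Pk (All-insertMany c k M Pk PM)

remove-nonIncreasing : ∀ k M → NonIncreasing M → NonIncreasing (remove k M)
remove-nonIncreasing k [] M↓ = M↓
remove-nonIncreasing k (y ∷ M) (M≤y ∷ M↓) with y ≟ k
... | yes _ = M↓
... | no _ = All-remove k M M≤y ∷ remove-nonIncreasing k M M↓

removeMany-nonIncreasing : ∀ c k M → NonIncreasing M → NonIncreasing (removeMany c k M)
removeMany-nonIncreasing zero k M M↓ = M↓
removeMany-nonIncreasing (suc c) k M M↓ = removeMany-nonIncreasing c k (remove k M) (remove-nonIncreasing k M M↓)

insert-nonIncreasing : ∀ k M → NonIncreasing M → NonIncreasing (insert k M)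
insert-nonIncreasing k [] _ = [] ∷ []
insert-nonIncreasing k (y ∷ M) (M≤y ∷ M↓) with y ≤? k
... | yes y≤k = (y≤k ∷ All.map (λ z≤y → ≤-trans z≤y y≤k) M≤y) ∷ M≤y ∷ M↓
... | no y≰k = All-insert k M (≰⇒≥ y≰k) M≤y ∷ insert-nonIncreasing k M M↓

insertMany-nonIncreasing : ∀ c k M → NonIncreasing M → NonIncreasing (insertMany c k M)
insertMany-nonIncreasing zero k M M↓ = M↓
insertMany-nonIncreasing (suc c) k M M↓ = insert-nonIncreasing k (insertMany c k M) (insertMany-nonIncreasing c k M M↓)

insertMany-removeMany : ∀ c k M → NonIncreasing M → c ≤ occ k M → insertMany c k (removeMany c k M) ≡ M
insertMany-removeMany zero k M _ _ = refl
insertMany-removeMany (suc c) k M M↓ c<occ =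
  trans (cong (insert k) (insertMany-removeMany c k (remove k M) (remove-nonIncreasing k M M↓) c≤occ′))
        (insert-remove k M M↓ (≤-trans (s≤s z≤n) c<occ))
  where
  c≤occ′ : c ≤ occ k (remove k M)
  c≤occ′ = subst (c ≤_) (sym (occ-remove-same k M)) (∸-monoˡ-≤ 1 c<occ)

sum-insert : ∀ k M → sum (insert k M) ≡ k + sum M
sum-insert k [] = refl
sum-insert k (y ∷ M) with y ≤? k
... | yes _ = refl
... | no _ = trans (cong (y +_) (sum-insert k M)) (x∙yz≈y∙xz y k (sum M))

sum-insertMany : ∀ c k M → sum (insertMany c k M) ≡ c * k + sum M
sum-insertMany zero k M = refl
sum-insertMany (suc c) k M =
  trans (sum-insert k (insertMany c k M)) (trans (cong (k +_) (sum-insertMany c k M)) (sym (+-assoc k (c * k) (sum M))))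

-- Sets of parts and multisets of bases

PartSet : ℕ → List ℕ → Set
PartSet N S = Linked _>_ S × All (2 ≤_) S × All (_≤ N) S

BaseMultiset : ℕ → List ℕ → Set
BaseMultiset N M = NonIncreasing M × All Base M × (∀ k → Base k → PowCond k (occ k M) N)

expand : List ℕ → List ℕ
expand [] = []
expand (x ∷ S) = insertMany (2 ^ exponent x) (base x) (expand S)

collect : ℕ → List ℕ → List ℕ
collect zero M = []
collect (suc N) M with 2 ^ exponent (suc N) ≤? occ (base (suc N)) M
... | yes _ = suc N ∷ collect N (removeMany (2 ^ exponent (suc N)) (base (suc N)) M)
... | no _ = collect N M

PartSet-tail : ∀ {N x S} → PartSet N (suc x ∷ S) → PartSet x S
PartSet-tail (S> , _ ∷ S≥2 , _) = Linked.tail S> , S≥2 , All.map ≤-pred (decreasing⇒below-head S>)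

PartSet-pred : ∀ {N x S} → PartSet (suc N) (x ∷ S) → x ≢ suc N → PartSet N (x ∷ S)
PartSet-pred (S> , S≥2 , x≤1+N ∷ _) x≢1+N =
  S> , S≥2 , x≤N ∷ All.map (λ y<x → ≤-trans (<⇒≤ y<x) x≤N) (decreasing⇒below-head S>)
  where
  x≤N = ≤-pred (≤∧≢⇒< x≤1+N x≢1+N)

PartSet-mono : ∀ {N N′ S} → N ≤ N′ → PartSet N S → PartSet N′ S
PartSet-mono N≤N′ (S> , S≥2 , S≤N) = S> , S≥2 , All.map (λ x≤N → ≤-trans x≤N N≤N′) S≤N

PartSet-cons⇒≥2 : ∀ {N x S} → PartSet N (x ∷ S) → 2 ≤ N
PartSet-cons⇒≥2 (_ , x≥2 ∷ _ , x≤N ∷ _) = ≤-trans x≥2 x≤N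

PartSet-empty : ∀ {N S} → N < 2 → PartSet N S → S ≡ []
PartSet-empty {S = []} _ _ = refl
PartSet-empty {S = _ ∷ _} N<2 S-part = ⊥-elim (<⇒≱ N<2 (PartSet-cons⇒≥2 S-part))

BaseMultiset-head≤ : ∀ {N k M} → BaseMultiset N (k ∷ M) → k ≤ N
BaseMultiset-head≤ {k = k} {M} (_ , k-base ∷ _ , powCond) =
  PowCond⇒base≤ {k} {occ k (k ∷ M)} (powCond k k-base) (subst (0 <_) (sym (occ-here k M)) (s≤s z≤n))

BaseMultiset-empty : ∀ {N M} → N < 2 → BaseMultiset N M → M ≡ []
BaseMultiset-empty {M = []} _ _ = refl
BaseMultiset-empty {M = k ∷ M} N<2 bm@(_ , k-base ∷ _ , _) =
  ⊥-elim (<⇒≱ N<2 (≤-trans (Base⇒≥2 k-base) (BaseMultiset-head≤ bm)))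

expand-valid : ∀ N S → PartSet N S → BaseMultiset N (expand S)
expand-valid N [] _ = [] , [] , λ k _ → PowCond-zero {k} {N}
expand-valid N (suc x ∷ S) S-part@(_ , 1+x≥2 ∷ _ , 1+x≤N ∷ _) =
  insertMany-nonIncreasing (2 ^ j) k M M↓ , All-insertMany (2 ^ j) k M k-base M-bases , powCond
  where
  k = base (suc x)
  j = exponent (suc x)
  k-base = proj₁ (base-spec (suc x) 1+x≥2)
  k*2^j≡1+x = proj₂ (base-spec (suc x) 1+x≥2)
  M = expand S
  M-valid = expand-valid x S (PartSet-tail S-part)
  M↓ = proj₁ M-valid
  M-bases = proj₁ (proj₂ M-valid)
  u<2^j : occ k M < 2 ^ j
  u<2^j with 2 ^ j ≤? occ k M
  ... | yes 2^j≤u =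
    ⊥-elim (<⇒≱ (subst (x <_) (sym k*2^j≡1+x) ≤-refl) (PowCond⇒≤ {k} {occ k M} {j = j} (proj₂ (proj₂ M-valid) k k-base) 2^j≤u))
  ... | no 2^j≰u = ≰⇒> 2^j≰u
  powCond : ∀ q → Base q → PowCond q (occ q (insertMany (2 ^ j) k M)) N
  powCond q q-base with q ≟ k
  ... | yes refl = subst (λ u → PowCond q u N) (sym (occ-insertMany-same (2 ^ j) q M))
                     (PowCond-mono {q} (subst (_≤ N) (sym k*2^j≡1+x) 1+x≤N) (PowCond-+ {q} {occ q M} {j} u<2^j))
  ... | no q≢k = subst (λ u → PowCond q u N) (sym (occ-insertMany-other (2 ^ j) k q M q≢k))
                   (PowCond-mono {q} {occ q M} (≤-trans (n≤1+n x) 1+x≤N) (proj₂ (proj₂ M-valid) q q-base))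

collect-expand : ∀ N S → PartSet N S → collect N (expand S) ≡ S
collect-expand zero S S-part = sym (PartSet-empty (s≤s z≤n) S-part)
collect-expand (suc N) [] _ with 2 ^ exponent (suc N) ≤? 0
... | yes 2^j≤0 = ⊥-elim (<⇒≱ (m^n>0 2 (exponent (suc N))) 2^j≤0)
... | no _ = collect-expand N [] ([] , [] , [])
collect-expand (suc N) (x ∷ S) S-part with x ≟ suc N
... | yes refl with 2 ^ exponent x ≤? occ (base x) (expand (x ∷ S))
...   | yes _ = cong (x ∷_) (trans (cong (collect N) (removeMany-insertMany (2 ^ exponent x) (base x) (expand S)))
                                  (collect-expand N S (PartSet-tail S-part)))
...   | no 2^j≰u =
  ⊥-elim (2^j≰u (subst (2 ^ exponent x ≤_) (sym (occ-insertMany-same (2 ^ exponent x) (base x) (expand S))) (m≤m+n _ _)))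
collect-expand (suc N) (x ∷ S) S-part | no x≢1+N with 2 ^ exponent (suc N) ≤? occ (base (suc N)) (expand (x ∷ S))
... | no _ = collect-expand N (x ∷ S) (PartSet-pred S-part x≢1+N)
... | yes 2^j≤u = ⊥-elim (<⇒≱ (subst (N <_) (sym (proj₂ spec)) ≤-refl)
                         (PowCond⇒≤ {k} {occ k (expand (x ∷ S))} {j = exponent (suc N)} powCond 2^j≤u))
  where
  S-part′ = PartSet-pred S-part x≢1+N
  spec = base-spec (suc N) (m≤n⇒m≤1+n (PartSet-cons⇒≥2 S-part′))
  k = base (suc N)
  powCond = proj₂ (proj₂ (expand-valid N (x ∷ S) S-part′)) k (proj₁ spec)

-- By uniqueness of bases no multiple q · 2 ^ a of another base equals suc N.
PowCond-otherBase : ∀ {N q u} → 1 ≤ N → Base q → q ≢ base (suc N) → PowCond q u (suc N) → PowCond q u N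
PowCond-otherBase {N} {q} {u} N≥1 q-base q≢k pc = PowCond-pred {q} {u} pc λ a q*2^a≡1+N →
  q≢k (base-unique a (exponent (suc N)) q-base (proj₁ spec) (trans q*2^a≡1+N (sym (proj₂ spec))))
  where
  spec = base-spec (suc N) (s≤s N≥1)

BaseMultiset-skip : ∀ {N M} → 1 ≤ N → BaseMultiset (suc N) M → occ (base (suc N)) M < 2 ^ exponent (suc N) →
  BaseMultiset N M
BaseMultiset-skip {N} {M} N≥1 (M↓ , M-bases , powCond) u<2^j = M↓ , M-bases , powCond′
  where
  spec = base-spec (suc N) (s≤s N≥1)
  powCond′ : ∀ q → Base q → PowCond q (occ q M) N
  powCond′ q q-base with q ≟ base (suc N)
  ... | yes refl = PowCond-< {q} {occ q M} {exponent (suc N)} (Base⇒≥1 q-base) u<2^j (≤-reflexive (proj₂ spec))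
  ... | no q≢k = PowCond-otherBase N≥1 q-base q≢k (powCond q q-base)

BaseMultiset-take : ∀ {N M} → 1 ≤ N → BaseMultiset (suc N) M → 2 ^ exponent (suc N) ≤ occ (base (suc N)) M →
  BaseMultiset N (removeMany (2 ^ exponent (suc N)) (base (suc N)) M)
BaseMultiset-take {N} {M} N≥1 (M↓ , M-bases , powCond) c≤u =
  removeMany-nonIncreasing c k M M↓ , All-removeMany c k M M-bases , powCond′
  where
  spec = base-spec (suc N) (s≤s N≥1)
  k = base (suc N)
  c = 2 ^ exponent (suc N)
  powCond′ : ∀ q → Base q → PowCond q (occ q (removeMany c k M)) N
  powCond′ q q-base with q ≟ k
  ... | yes refl = subst (λ u → PowCond q u N) (sym (occ-removeMany-same c q M))
                     (PowCond-< {q} {occ q M ∸ c} {exponent (suc N)} (Base⇒≥1 q-base) u∸c<c (≤-reflexive (proj₂ spec)))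
    where
    u<c+c : occ q M < c + c
    u<c+c = subst (occ q M <_) (cong (c +_) (+-identityʳ c))
              (PowCond-tight⇒< {q} {occ q M} {exponent (suc N)} (Base⇒≥1 q-base)
                 (subst (PowCond q (occ q M)) (sym (proj₂ spec)) (powCond q q-base)) c≤u)
    u∸c<c : occ q M ∸ c < c
    u∸c<c = +-cancelˡ-< c (occ q M ∸ c) c (subst (_< c + c) (sym (m+[n∸m]≡n c≤u)) u<c+c)
  ... | no q≢k = subst (λ u → PowCond q u N) (sym (occ-removeMany-other c k q M q≢k))
                   (PowCond-otherBase N≥1 q-base q≢k (powCond q q-base))

Collected : ℕ → List ℕ → Set
Collected N M = PartSet N (collect N M) × expand (collect N M) ≡ M

collect-valid-step : ∀ N → (∀ M → BaseMultiset (suc N) M → Collected (suc N) M) →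
  ∀ M → BaseMultiset (2 + N) M → Collected (2 + N) M
collect-valid-step N collect-valid M bm with 2 ^ exponent (2 + N) ≤? occ (base (2 + N)) M
... | no c≰u = PartSet-mono (n≤1+n (suc N)) (proj₁ rest) , proj₂ rest
  where
  rest = collect-valid M (BaseMultiset-skip (s≤s z≤n) bm (≰⇒> c≰u))
... | yes c≤u = (Linked-∷ (All.map s≤s S≤N) S> , s≤s (s≤s z≤n) ∷ S≥2 , ≤-refl ∷ All.map m≤n⇒m≤1+n S≤N) ,
                trans (cong (insertMany c k) (proj₂ rest)) (insertMany-removeMany c k M (proj₁ bm) c≤u)
  where
  k = base (2 + N)
  c = 2 ^ exponent (2 + N)
  rest = collect-valid (removeMany c k M) (BaseMultiset-take (s≤s z≤n) bm c≤u)
  S> = proj₁ (proj₁ rest)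
  S≥2 = proj₁ (proj₂ (proj₁ rest))
  S≤N = proj₂ (proj₂ (proj₁ rest))

collect-valid : ∀ N M → BaseMultiset N M → Collected N M
collect-valid zero M bm rewrite BaseMultiset-empty (s≤s z≤n) bm = ([] , [] , []) , refl
collect-valid (suc zero) M bm rewrite BaseMultiset-empty (s≤s (s≤s z≤n)) bm with 2 ^ exponent 1 ≤? 0
... | yes 2^j≤0 = ⊥-elim (<⇒≱ (m^n>0 2 (exponent 1)) 2^j≤0)
... | no _ = ([] , [] , []) , refl
collect-valid (suc (suc N)) = collect-valid-step N (collect-valid (suc N))

sum-expand : ∀ S → All (2 ≤_) S → sum (expand S) ≡ sum S
sum-expand [] [] = refl
sum-expand (x ∷ S) (x≥2 ∷ S≥2) = trans (sum-insertMany (2 ^ exponent x) (base x) (expand S))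
  (cong₂ _+_ (trans (*-comm (2 ^ exponent x) (base x)) (proj₂ (base-spec x x≥2))) (sum-expand S S≥2))

oddParts : List ℕ → List ℕ
oddParts = filter (3 ≤?_)

withTwos : ℕ → List ℕ → List ℕ
withTwos t md = md ++ replicate t 2

occ-++ : ∀ k xs ys → occ k (xs ++ ys) ≡ occ k xs + occ k ys
occ-++ k xs ys = trans (cong length (filter-++ (_≟ k) xs ys)) (length-++ (filter (_≟ k) xs))

occ-replicate-same : ∀ k t → occ k (replicate t k) ≡ t
occ-replicate-same k zero = refl
occ-replicate-same k (suc t) = trans (occ-here k (replicate t k)) (cong suc (occ-replicate-same k t))

occ-absent : ∀ {q} xs → All (_≢ q) xs → occ q xs ≡ 0
occ-absent [] [] = refl
occ-absent (x ∷ xs) (x≢q ∷ xs≢q) = trans (occ-there xs x≢q) (occ-absent xs xs≢q)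

≥3⇒≢2 : ∀ {x} → 3 ≤ x → x ≢ 2
≥3⇒≢2 (s≤s (s≤s ())) refl

occ-++-absent : ∀ {q} xs ys → All (_≢ q) ys → occ q (xs ++ ys) ≡ occ q xs
occ-++-absent xs ys ys≢q = trans (occ-++ _ xs ys) (trans (cong (_ +_) (occ-absent ys ys≢q)) (+-identityʳ _))

occ-withTwos-odd : ∀ {k} t md → k ≢ 2 → occ k (withTwos t md) ≡ occ k md
occ-withTwos-odd t md k≢2 = occ-++-absent md (replicate t 2) (All.replicate⁺ t (k≢2 ∘ sym))

occ2-withTwos : ∀ t md → All (3 ≤_) md → occ 2 (withTwos t md) ≡ t
occ2-withTwos t md md≥3 =
  trans (occ-++ 2 md (replicate t 2)) (cong₂ _+_ (occ-absent md (All.map ≥3⇒≢2 md≥3)) (occ-replicate-same 2 t))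

oddParts-withTwos : ∀ t md → All (3 ≤_) md → oddParts (withTwos t md) ≡ md
oddParts-withTwos t md md≥3 = begin
  oddParts (md ++ replicate t 2)             ≡⟨ filter-++ (3 ≤?_) md (replicate t 2) ⟩
  oddParts md ++ oddParts (replicate t 2)    ≡⟨ cong₂ _++_ (filter-all (3 ≤?_) md≥3) (filter-none (3 ≤?_) (All.replicate⁺ t (≤⇒≯ ≤-refl))) ⟩
  md ++ []                                   ≡⟨ ++-identityʳ md ⟩
  md                                         ∎
  where open ≡-Reasoning

Bases-split : ∀ M → NonIncreasing M → All Base M → M ≡ withTwos (occ 2 M) (oddParts M)
Bases-split [] _ _ = refl
Bases-split (_ ∷ M) (M≤2 ∷ M↓) (inj₁ refl ∷ M-bases) = begin
  2 ∷ M                                       ≡⟨ cong (2 ∷_) (Bases-split M M↓ M-bases) ⟩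
  2 ∷ oddParts M ++ replicate (occ 2 M) 2     ≡⟨ cong (λ md → 2 ∷ md ++ replicate (occ 2 M) 2) (no-odd M≤2) ⟩
  replicate (suc (occ 2 M)) 2                 ≡⟨ cong (λ t → replicate t 2) (occ-here 2 M) ⟨
  replicate (occ 2 (2 ∷ M)) 2                 ≡⟨ cong (_++ replicate (occ 2 (2 ∷ M)) 2) (no-odd (≤-refl ∷ M≤2)) ⟨
  withTwos (occ 2 (2 ∷ M)) (oddParts (2 ∷ M)) ∎
  where
  open ≡-Reasoning
  no-odd : ∀ {xs} → All (_≤ 2) xs → oddParts xs ≡ []
  no-odd xs≤2 = filter-none (3 ≤?_) (All.map ≤⇒≯ xs≤2)
Bases-split (x ∷ M) (_ ∷ M↓) (inj₂ (_ , x≥3) ∷ M-bases) = begin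
  x ∷ M                                       ≡⟨ cong (x ∷_) (Bases-split M M↓ M-bases) ⟩
  x ∷ withTwos (occ 2 M) (oddParts M)         ≡⟨ cong (λ t → x ∷ withTwos t (oddParts M)) (occ-there M (≥3⇒≢2 x≥3)) ⟨
  x ∷ withTwos (occ 2 (x ∷ M)) (oddParts M)   ≡⟨ cong (withTwos (occ 2 (x ∷ M))) (filter-accept (3 ≤?_) x≥3) ⟨
  withTwos (occ 2 (x ∷ M)) (oddParts (x ∷ M)) ∎
  where open ≡-Reasoning

sum-withTwos : ∀ t md → sum (withTwos t md) ≡ sum md + t * 2
sum-withTwos t md = trans (sum-++ md (replicate t 2)) (cong (sum md +_) (sum-twos t))
  where
  sum-twos : ∀ t → sum (replicate t 2) ≡ t * 2
  sum-twos zero = refl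
  sum-twos (suc t) = cong (2 +_) (sum-twos t)

PowConditions : ℕ → List ℕ → ℕ → Set
PowConditions t md B = PowCond 2 t B × (∀ q → Odd q → 5 ≤ q → PowCond q (occ q md) B) × PowCond 3 (occ 3 md) B

withTwos-nonIncreasing : ∀ t md → NonIncreasing md → All (3 ≤_) md → NonIncreasing (withTwos t md)
withTwos-nonIncreasing t md md↓ md≥3 =
  AllPairs.++⁺ md↓ (twos↓ t) (All.map (λ x≥3 → All.replicate⁺ t (≤-trans (n≤1+n 2) x≥3)) md≥3)
  where
  twos↓ : ∀ t → NonIncreasing (replicate t 2)
  twos↓ zero = []
  twos↓ (suc t) = All.replicate⁺ t ≤-refl ∷ twos↓ t

≥5⇒≥3 : ∀ {q} → 5 ≤ q → 3 ≤ q
≥5⇒≥3 = ≤-trans (s≤s (s≤s (s≤s z≤n)))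

BaseMultiset-withTwos : ∀ {t md B} → NonIncreasing md → All OddGe3 md → PowConditions t md B → BaseMultiset B (withTwos t md)
BaseMultiset-withTwos {t} {md} {B} md↓ md-odd (pc₂ , pc≥5 , pc₃) =
  withTwos-nonIncreasing t md md↓ md≥3 , All.++⁺ (All.map inj₂ md-odd) (All.replicate⁺ t (inj₁ refl)) , powCond
  where
  md≥3 = All.map proj₂ md-odd
  powCond : ∀ k → Base k → PowCond k (occ k (withTwos t md)) B
  powCond k (inj₁ refl) = subst (λ u → PowCond 2 u B) (sym (occ2-withTwos t md md≥3)) pc₂
  powCond k (inj₂ k-odd) with OddGe3-split k-odd
  ... | inj₁ refl = subst (λ u → PowCond 3 u B) (sym (occ-withTwos-odd t md (λ ()))) pc₃
  ... | inj₂ k≥5 =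
    subst (λ u → PowCond k u B) (sym (occ-withTwos-odd t md (≥3⇒≢2 (≥5⇒≥3 k≥5)))) (pc≥5 k (proj₁ k-odd) k≥5)

PowConditions-withTwos : ∀ {t md B} → All (3 ≤_) md → BaseMultiset B (withTwos t md) → PowConditions t md B
PowConditions-withTwos {t} {md} {B} md≥3 (_ , _ , powCond) =
  subst (λ u → PowCond 2 u B) (occ2-withTwos t md md≥3) (powCond 2 (inj₁ refl)) ,
  (λ q q-odd q≥5 →
     subst (λ u → PowCond q u B) (occ-withTwos-odd t md (≥3⇒≢2 (≥5⇒≥3 q≥5))) (powCond q (inj₂ (q-odd , ≥5⇒≥3 q≥5)))) ,
  subst (λ u → PowCond 3 u B) (occ-withTwos-odd t md (λ ())) (powCond 3 (inj₂ (refl , ≤-refl)))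

oddParts-odd : ∀ M → All Base M → All OddGe3 (oddParts M)
oddParts-odd M M-bases = All.zipWith odd (All.all-filter (3 ≤?_) M , All.filter⁺ (3 ≤?_) M-bases)
  where
  odd : ∀ {x} → 3 ≤ x × Base x → OddGe3 x
  odd (s≤s (s≤s ()) , inj₁ refl)
  odd (_ , inj₂ x-odd) = x-odd

-- Butterflies and the partitions counted by o_e(n)

butterfly : ℕ → List ℕ → List ℕ
butterfly Q S = Q + 1 + 1 ∷ Q + 1 ∷ Q ∷ S

second : List ℕ → ℕ
second (_ ∷ p₂ ∷ _) = p₂
second _ = 0

decreasing⇒≥last : ∀ {b} l → Linked _>_ l → (∀ p → last l ≡ just p → b ≤ p) → All (b ≤_) l
decreasing⇒≥last [] _ _ = []
decreasing⇒≥last (x ∷ []) _ last≥b = last≥b x refl ∷ []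
decreasing⇒≥last (x ∷ y ∷ l) (x>y ∷ l>) last≥b with decreasing⇒≥last (y ∷ l) l> last≥b
... | y≥b ∷ l≥b = ≤-trans y≥b (<⇒≤ x>y) ∷ y≥b ∷ l≥b

All⇒last : ∀ {P : ℕ → Set} l → All P l → ∀ p → last l ≡ just p → P p
All⇒last (x ∷ []) (Px ∷ []) _ refl = Px
All⇒last (x ∷ y ∷ l) (_ ∷ Pl) p last≡p = All⇒last (y ∷ l) Pl p last≡p

<⇒≤∸1 : ∀ {y Q} → y < Q → y ≤ Q ∸ 1
<⇒≤∸1 (s≤s y≤) = y≤

Butterfly-view : ∀ {n l} → Butterfly n l →
  ∃ λ Q → ∃ λ S → l ≡ butterfly Q S × PartSet (Q ∸ 1) S × 2 ≤ Q × sum l ≡ n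
Butterfly-view ((Σl , _ , l>) , _ , _ , Q , S , refl , refl , refl , last≥2) with decreasing⇒≥last _ l> last≥2
... | _ ∷ _ ∷ Q≥2 ∷ S≥2 =
  Q , S , refl , (Linked.tail Q∷S> , S≥2 , All.map <⇒≤∸1 (decreasing⇒below-head Q∷S>)) , Q≥2 , Σl
  where
  Q∷S> = Linked.tail (Linked.tail l>)

Butterfly-intro : ∀ Q S → PartSet (Q ∸ 1) S → 2 ≤ Q → Butterfly (sum (butterfly Q S)) (butterfly Q S)
Butterfly-intro Q@(suc R) S (S> , S≥2 , S≤R) Q≥2 =
  (refl , All.map (≤-trans (s≤s z≤n)) l≥2 , l>) , Q + 1 + 1 , Q + 1 , Q , S , refl , refl , refl , All⇒last _ l≥2
  where
  l> : Linked _>_ (butterfly Q S)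
  l> = m<m+n (Q + 1) (s≤s z≤n) ∷ m<m+n Q (s≤s z≤n) ∷ Linked-∷ (All.map s≤s S≤R) S>
  l≥2 : All (2 ≤_) (butterfly Q S)
  l≥2 = ≤-trans Q≥2 (≤-trans (m≤m+n Q 1) (m≤m+n (Q + 1) 1)) ∷ ≤-trans Q≥2 (m≤m+n Q 1) ∷ Q≥2 ∷ S≥2

Butterfly⇔DistinctNoOneRun₃ : ∀ {m} l → Butterfly m l ⇔ DistinctNoOneRun₃ m l
Butterfly⇔DistinctNoOneRun₃ {m} l = mk⇔ to (from l)
  where
  to : Butterfly m l → DistinctNoOneRun₃ m l
  to (dp@(_ , _ , l>) , _ , _ , _ , _ , refl , p₁≡ , p₂≡ , last≥2) =
    (dp , decreasing⇒≥last l l> last≥2) , p₁≡ , p₂≡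
  from : ∀ l → DistinctNoOneRun₃ m l → Butterfly m l
  from l@(p₁ ∷ p₂ ∷ p₃ ∷ rest) ((dp , l≥2) , run) =
    dp , p₁ , p₂ , p₃ , rest , refl , proj₁ run , proj₂ run , All⇒last l l≥2

AllPairs-++⁻ˡ : ∀ {R : ℕ → ℕ → Set} xs {ys} → AllPairs R (xs ++ ys) → AllPairs R xs
AllPairs-++⁻ˡ [] _ = []
AllPairs-++⁻ˡ (x ∷ xs) (Rx ∷ Rxs) = All.++⁻ˡ xs Rx ∷ AllPairs-++⁻ˡ xs Rxs

snoc3-nonIncreasing : ∀ md → NonIncreasing md → All (3 ≤_) md → Linked _≥_ (md ++ [ 3 ])
snoc3-nonIncreasing md md↓ md≥3 = AllPairs⇒Linked (AllPairs.++⁺ md↓ ([] ∷ []) (All.map (_∷ []) md≥3))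

occ-snoc3 : ∀ {q} md → 5 ≤ q → occ q (md ++ [ 3 ]) ≡ occ q md
occ-snoc3 md q≥5 = occ-++-absent md [ 3 ] (<⇒≢ (≤-trans (n≤1+n 4) q≥5) ∷ [])

oe : ℕ → ℕ → List ℕ → List ℕ
oe Q t md = Q + t * 2 ∷ Q ∷ Q ∷ md ++ [ 3 ]

OE-view : ∀ {n l} → OE n l → ∃ λ Q → ∃ λ t → ∃ λ md →
  l ≡ oe Q t md × BaseMultiset (Q ∸ 1) (withTwos t md) × All OddGe3 md × OddGe3 Q × sum l ≡ n
OE-view ((Σl , _ , q₁≥Q ∷ _ ∷ _ ∷ tail≥) , q₁-odd ∷ Q-odd ∷ _ ∷ tail-odd ,
         q₁ , Q , _ , _ , _ , md , refl , refl , tail≡ , _ , pc₂ , pc≥5 , pc₃) =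
  Q , t , md , cong₂ _∷_ q₁≡ (cong (λ ys → Q ∷ Q ∷ ys) tail≡) ,
  BaseMultiset-withTwos md↓ md-odd (pc₂ , pc≥5′ , pc₃) , md-odd , Q-odd , Σl
  where
  t = (q₁ ∸ Q) / 2
  q₁≡ : q₁ ≡ Q + t * 2
  q₁≡ = Odd-difference {q₁} {Q} (proj₁ q₁-odd) (proj₁ Q-odd) q₁≥Q
  md-odd : All OddGe3 md
  md-odd = All.++⁻ˡ md (subst (All OddGe3) tail≡ tail-odd)
  md↓ : NonIncreasing md
  md↓ = AllPairs-++⁻ˡ md (Linked⇒AllPairs (λ x≥y y≥z → ≤-trans y≥z x≥y) (subst (Linked _≥_) tail≡ tail≥))
  pc≥5′ : ∀ q → Odd q → 5 ≤ q → PowCond q (occ q md) (Q ∸ 1)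
  pc≥5′ q q-odd q≥5 = subst (λ u → PowCond q u (Q ∸ 1)) occ≡ (pc≥5 q q-odd q≥5)
    where
    occ≡ = trans (cong (occ q) tail≡) (occ-snoc3 md q≥5)

oe-tail : ∀ {R t} md → 2 ≤ R → BaseMultiset R (withTwos t md) → Linked _≥_ (md ++ [ 3 ]) →
  ∃ λ q₄ → ∃ λ rest → q₄ ∷ rest ≡ md ++ [ 3 ] ×
    (suc R > q₄ ⊎ (suc R ≡ 3 × suc R ≡ 3 × q₄ ≡ 3)) × Linked _≥_ (suc R ∷ q₄ ∷ rest)
oe-tail [] R≥2 _ _ with m≤n⇒m<n∨m≡n R≥2
... | inj₁ R>2 = 3 , [] , refl , inj₁ (s≤s R>2) , s≤s R≥2 ∷ [-]
... | inj₂ refl = 3 , [] , refl , inj₂ (refl , refl , refl) , ≤-refl ∷ [-]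
oe-tail (h ∷ r) _ bm tail≥ = h , r ++ [ 3 ] , refl , inj₁ (s≤s h≤R) , m≤n⇒m≤1+n h≤R ∷ tail≥
  where
  h≤R = BaseMultiset-head≤ bm

[m+t*2∸m]/2≡t : ∀ Q t → (Q + t * 2 ∸ Q) / 2 ≡ t
[m+t*2∸m]/2≡t Q t = trans (cong (_/ 2) (m+n∸m≡n Q (t * 2))) (m*n/n≡m t 2)

OE-intro : ∀ Q t md → BaseMultiset (Q ∸ 1) (withTwos t md) → All OddGe3 md → OddGe3 Q →
  OE (sum (oe Q t md)) (oe Q t md)
OE-intro Q@(suc R) t md bm md-odd Q-odd@(Q-odd′ , s≤s R≥2)
  with oe-tail md R≥2 bm (snoc3-nonIncreasing md (AllPairs-++⁻ˡ md (proj₁ bm)) (All.map proj₂ md-odd))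
... | q₄ , rest , tail≡ , Q>q₄ , Q∷tail≥ =
  (refl , All.map (λ (_ , x≥3) → ≤-trans (s≤s z≤n) x≥3) l-odd ,
   m≤m+n Q (t * 2) ∷ ≤-refl ∷ subst (λ ys → Linked _≥_ (Q ∷ ys)) tail≡ Q∷tail≥) ,
  l-odd ,
  Q + t * 2 , Q , Q , q₄ , rest , md , cong (λ ys → Q + t * 2 ∷ Q ∷ Q ∷ ys) (sym tail≡) , refl , tail≡ , Q>q₄ ,
  subst (λ t′ → PowCond 2 t′ R) (sym ([m+t*2∸m]/2≡t Q t)) pc₂ ,
  (λ q q-odd q≥5 →
     subst (λ u → PowCond q u R) (sym (trans (cong (occ q) tail≡) (occ-snoc3 md q≥5))) (pc≥5 q q-odd q≥5)) ,
  pc₃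
  where
  pcs = PowConditions-withTwos (All.map proj₂ md-odd) bm
  pc₂ = proj₁ pcs
  pc≥5 = proj₁ (proj₂ pcs)
  pc₃ = proj₂ (proj₂ pcs)
  l-odd : All OddGe3 (oe Q t md)
  l-odd = (Odd-+-even {Q} t Q-odd′ , ≤-trans (s≤s R≥2) (m≤m+n Q (t * 2))) ∷ Q-odd ∷ Q-odd ∷
          All.++⁺ md-odd ((refl , ≤-refl) ∷ [])

ButterflyE-view : ∀ {n l} → ButterflyE n l →
  ∃ λ Q → ∃ λ S → l ≡ butterfly Q S × PartSet (Q ∸ 1) S × OddGe3 Q × sum l ≡ n
ButterflyE-view (b , _ , _ , _ , l≡ , p₂-even) with Butterfly-view b
... | Q , S , refl , S-part , Q≥2 , Σl with l≡
...   | refl = Q , S , refl , S-part , (Q-odd , Odd⇒≥3 {Q} Q-odd Q≥2) , Σl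
  where
  Q-odd = Even-suc⇒Odd {Q} p₂-even

ButterflyE-intro : ∀ Q S → PartSet (Q ∸ 1) S → OddGe3 Q → ButterflyE (sum (butterfly Q S)) (butterfly Q S)
ButterflyE-intro Q S S-part (Q-odd , Q≥3) =
  Butterfly-intro Q S S-part (≤-trans (n≤1+n 2) Q≥3) , _ , _ , _ , refl , Odd⇒Even-suc {Q} Q-odd

toOE : List ℕ → List ℕ
toOE (_ ∷ _ ∷ Q ∷ S) = oe Q (occ 2 (expand S)) (oddParts (expand S))
toOE _ = []

fromOE : List ℕ → List ℕ
fromOE (q₁ ∷ q₂ ∷ Q ∷ tail) = butterfly Q (collect (Q ∸ 1) (withTwos ((q₁ ∸ q₂) / 2) (dropLast tail)))
fromOE _ = []

fromOE-oe : ∀ Q t md → fromOE (oe Q t md) ≡ butterfly Q (collect (Q ∸ 1) (withTwos t md))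
fromOE-oe Q t md = cong (λ M → butterfly Q (collect (Q ∸ 1) M)) (cong₂ withTwos ([m+t*2∸m]/2≡t Q t) (dropLast-snoc md 3))

sum-oe : ∀ Q t md S → sum S ≡ sum (withTwos t md) → sum (oe Q t md) ≡ sum (butterfly Q S)
sum-oe Q t md S ΣS = begin
  Q + t * 2 + (Q + (Q + sum (md ++ [ 3 ])))        ≡⟨ cong (λ s → Q + t * 2 + (Q + (Q + s))) (sum-++ md [ 3 ]) ⟩
  Q + t * 2 + (Q + (Q + (sum md + 3)))             ≡⟨ rearrange Q t (sum md) ⟩
  Q + 1 + 1 + (Q + 1 + (Q + (sum md + t * 2)))     ≡⟨ cong (λ s → Q + 1 + 1 + (Q + 1 + (Q + s))) (sum-withTwos t md) ⟨
  Q + 1 + 1 + (Q + 1 + (Q + sum (withTwos t md)))  ≡⟨ cong (λ s → Q + 1 + 1 + (Q + 1 + (Q + s))) ΣS ⟨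
  sum (butterfly Q S)                               ∎
  where
  open ≡-Reasoning
  rearrange : ∀ Q t m → Q + t * 2 + (Q + (Q + (m + 3))) ≡ Q + 1 + 1 + (Q + 1 + (Q + (m + t * 2)))
  rearrange = solve-∀

expand-withTwos : ∀ {B} S → PartSet B S →
  let M = expand S ; t = occ 2 M ; md = oddParts M in
  M ≡ withTwos t md × BaseMultiset B (withTwos t md) × All OddGe3 md × sum S ≡ sum (withTwos t md)
expand-withTwos {B} S S-part =
  M≡ , subst (BaseMultiset B) M≡ M-valid , oddParts-odd (expand S) (proj₁ (proj₂ M-valid)) ,
  trans (sym (sum-expand S (proj₁ (proj₂ S-part)))) (cong sum M≡)
  where
  M-valid = expand-valid B S S-part
  M≡ = Bases-split (expand S) (proj₁ M-valid) (proj₁ (proj₂ M-valid))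

sum-collect : ∀ B M → BaseMultiset B M → sum (collect B M) ≡ sum M
sum-collect B M bm = trans (sym (sum-expand (collect B M) (proj₁ (proj₂ (proj₁ collected))))) (cong sum (proj₂ collected))
  where
  collected = collect-valid B M bm

toOE-valid : ∀ {n l} → ButterflyE n l → OE n (toOE l)
toOE-valid b with ButterflyE-view b
... | Q , S , refl , S-part , Q-odd , Σl with expand-withTwos S S-part
...   | _ , bm , md-odd , ΣS = subst (λ m → OE m (oe Q t md)) (trans (sum-oe Q t md S ΣS) Σl) (OE-intro Q t md bm md-odd Q-odd)
  where
  t = occ 2 (expand S)
  md = oddParts (expand S)

fromOE-valid : ∀ {n l} → OE n l → ButterflyE n (fromOE l)
fromOE-valid {n} o with OE-view o
... | Q , t , md , refl , bm , _ , Q-odd , Σl =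
  subst (ButterflyE n) (sym (fromOE-oe Q t md))
    (subst (λ m → ButterflyE m (butterfly Q S)) (trans (sym (sum-oe Q t md S (sum-collect (Q ∸ 1) (withTwos t md) bm))) Σl)
      (ButterflyE-intro Q S (proj₁ (collect-valid (Q ∸ 1) (withTwos t md) bm)) Q-odd))
  where
  S = collect (Q ∸ 1) (withTwos t md)

fromOE-toOE : ∀ {n l} → ButterflyE n l → fromOE (toOE l) ≡ l
fromOE-toOE b with ButterflyE-view b
... | Q , S , refl , S-part , _ , _ =
  trans (fromOE-oe Q (occ 2 (expand S)) (oddParts (expand S)))
    (cong (butterfly Q) (trans (cong (collect (Q ∸ 1)) (sym (proj₁ (expand-withTwos S S-part)))) (collect-expand (Q ∸ 1) S S-part)))

toOE-fromOE : ∀ {n l} → OE n l → toOE (fromOE l) ≡ l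
toOE-fromOE o with OE-view o
... | Q , t , md , refl , bm , md-odd , _ , _ =
  trans (cong toOE (fromOE-oe Q t md))
    (cong₂ (oe Q) (trans (cong (occ 2) expand-S) (occ2-withTwos t md md≥3))
                  (trans (cong oddParts expand-S) (oddParts-withTwos t md md≥3)))
  where
  md≥3 = All.map proj₂ md-odd
  expand-S = proj₂ (collect-valid (Q ∸ 1) (withTwos t md) bm)

-- Butterflies and the partitions counted by o_o(n)

oo : ℕ → ℕ → List ℕ → List ℕ
oo R t rest = R + 2 + (2 + t * 2) ∷ R + 2 ∷ R ∷ rest

OO-view : ∀ {n l} → OO n l → (l ≡ 3 ∷ 3 ∷ 3 ∷ [] × sum l ≡ n) ⊎
  (∃ λ R → ∃ λ t → ∃ λ rest →
     l ≡ oo R t rest × BaseMultiset R (withTwos t rest) × All OddGe3 rest × OddGe3 R × sum l ≡ n)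
OO-view ((Σl , _) , inj₁ refl) = inj₁ (refl , Σl)
OO-view ((Σl , _ , q₁≥q₂ ∷ _ ∷ R∷rest≥) ,
         inj₂ (q₁-odd ∷ q₂-odd ∷ R-odd ∷ rest-odd , q₁ , q₂ , R , rest , refl , gap≥2 , R≡ , pcs)) =
  inj₂ (R , t , rest , cong₂ _∷_ q₁≡ (cong (_∷ R ∷ rest) q₂≡) , BaseMultiset-withTwos rest↓ rest-odd pcs ,
        rest-odd , R-odd , Σl)
  where
  t = (q₁ ∸ q₂ ∸ 2) / 2
  q₂≡ : q₂ ≡ R + 2
  q₂≡ = trans (sym (m∸n+n≡m (≤-trans (n≤1+n 2) (proj₂ q₂-odd)))) (cong (_+ 2) (sym R≡))
  q₁≡ : q₁ ≡ R + 2 + (2 + t * 2)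
  q₁≡ = begin
    q₁                                     ≡⟨ Odd-difference {q₁} {q₂ + 2} (proj₁ q₁-odd) q₂+2-odd q₂+2≤q₁ ⟩
    q₂ + 2 + (q₁ ∸ (q₂ + 2)) / 2 * 2       ≡⟨ cong (λ d → q₂ + 2 + d / 2 * 2) (∸-+-assoc q₁ q₂ 2) ⟨
    q₂ + 2 + t * 2                         ≡⟨ +-assoc q₂ 2 (t * 2) ⟩
    q₂ + (2 + t * 2)                       ≡⟨ cong (_+ (2 + t * 2)) q₂≡ ⟩
    R + 2 + (2 + t * 2)                    ∎
    where
    open ≡-Reasoning
    q₂+2-odd = Odd-+-even {q₂} 1 (proj₁ q₂-odd)
    q₂+2≤q₁ = subst (q₂ + 2 ≤_) (m+[n∸m]≡n q₁≥q₂) (+-monoʳ-≤ q₂ gap≥2)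
  rest↓ : NonIncreasing rest
  rest↓ = Linked⇒AllPairs (λ x≥y y≥z → ≤-trans y≥z x≥y) (Linked.tail R∷rest≥)

BaseMultiset-withTwos⇒Linked : ∀ {R t} rest → BaseMultiset R (withTwos t rest) → Linked _≥_ (R ∷ rest)
BaseMultiset-withTwos⇒Linked [] _ = [-]
BaseMultiset-withTwos⇒Linked (h ∷ r) bm = BaseMultiset-head≤ bm ∷ AllPairs⇒Linked (AllPairs-++⁻ˡ (h ∷ r) (proj₁ bm))

OO-intro : ∀ R t rest → BaseMultiset R (withTwos t rest) → All OddGe3 rest → OddGe3 R → OO (sum (oo R t rest)) (oo R t rest)
OO-intro R t rest bm rest-odd R-odd@(R-odd′ , R≥3) =
  (refl , All.map (λ (_ , x≥3) → ≤-trans (s≤s z≤n) x≥3) l-odd ,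
   m≤m+n (R + 2) (2 + t * 2) ∷ m≤m+n R 2 ∷ BaseMultiset-withTwos⇒Linked rest bm) ,
  inj₂ (l-odd , R + 2 + (2 + t * 2) , R + 2 , R , rest , refl , gap≥2 , sym (m+n∸n≡m R 2) ,
        subst (λ t′ → PowCond 2 t′ R) (sym t≡) (proj₁ pcs) , proj₂ pcs)
  where
  pcs = PowConditions-withTwos (All.map proj₂ rest-odd) bm
  R+2-odd = Odd-+-even {R} 1 R-odd′
  l-odd : All OddGe3 (oo R t rest)
  l-odd = (Odd-+-even {R + 2} (suc t) R+2-odd , ≤-trans R≥3 (≤-trans (m≤m+n R 2) (m≤m+n (R + 2) _))) ∷
          (R+2-odd , ≤-trans R≥3 (m≤m+n R 2)) ∷ R-odd ∷ rest-odd
  gap≡ : R + 2 + (2 + t * 2) ∸ (R + 2) ≡ 2 + t * 2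
  gap≡ = m+n∸m≡n (R + 2) (2 + t * 2)
  gap≥2 : R + 2 + (2 + t * 2) ∸ (R + 2) ≥ 2
  gap≥2 = subst (2 ≤_) (sym gap≡) (m≤m+n 2 (t * 2))
  t≡ : (R + 2 + (2 + t * 2) ∸ (R + 2) ∸ 2) / 2 ≡ t
  t≡ = trans (cong (λ d → (d ∸ 2) / 2) gap≡) (m*n/n≡m t 2)

ButterflyO-view : ∀ {n l} → ButterflyO n l →
  ∃ λ P → ∃ λ S → l ≡ butterfly P S × PartSet (P ∸ 1) S × Even P × 2 ≤ P × sum l ≡ n
ButterflyO-view (b , _ , _ , _ , l≡ , p₂-odd) with Butterfly-view b
... | P , S , refl , S-part , P≥2 , Σl with l≡
...   | refl = P , S , refl , S-part , Odd-suc⇒Even {P} p₂-odd , P≥2 , Σl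

ButterflyO-intro : ∀ P S → PartSet (P ∸ 1) S → Even P → 2 ≤ P → ButterflyO (sum (butterfly P S)) (butterfly P S)
ButterflyO-intro P S S-part P-even P≥2 = Butterfly-intro P S S-part P≥2 , _ , _ , _ , refl , Even⇒Odd-suc {P} P-even

-- The butterfly 4 + 3 + 2 (P = 2) is matched with the exceptional partition 3 + 3 + 3.
toOO : List ℕ → List ℕ
toOO (_ ∷ _ ∷ P ∷ S) with P ≟ 2
... | yes _ = 3 ∷ 3 ∷ 3 ∷ []
... | no _ = oo (P ∸ 1) (occ 2 (expand S)) (oddParts (expand S))
toOO _ = []

fromOO : List ℕ → List ℕ
fromOO (q₁ ∷ q₂ ∷ R ∷ rest) with q₁ ≟ 3
... | yes _ = butterfly 2 []
... | no _ = butterfly (suc R) (collect R (withTwos ((q₁ ∸ q₂ ∸ 2) / 2) rest))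
fromOO _ = []

fromOO-oo : ∀ R t rest → fromOO (oo R t rest) ≡ butterfly (suc R) (collect R (withTwos t rest))
fromOO-oo R t rest with R + 2 + (2 + t * 2) ≟ 3
... | yes q₁≡3 = ⊥-elim (<-irrefl refl (subst (3 <_) q₁≡3 (+-mono-≤ (m≤n+m 2 R) (m≤m+n 2 (t * 2)))))
... | no _ = cong (λ t′ → butterfly (suc R) (collect R (withTwos t′ rest)))
                (trans (cong (λ d → (d ∸ 2) / 2) (m+n∸m≡n (R + 2) (2 + t * 2))) (m*n/n≡m t 2))

toOO-butterfly : ∀ P S → P ≢ 2 → toOO (butterfly P S) ≡ oo (P ∸ 1) (occ 2 (expand S)) (oddParts (expand S))
toOO-butterfly P S P≢2 with P ≟ 2
... | yes P≡2 = ⊥-elim (P≢2 P≡2)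
... | no _ = refl

sum-oo : ∀ R t rest S → sum S ≡ sum (withTwos t rest) → sum (oo R t rest) ≡ sum (butterfly (suc R) S)
sum-oo R t rest S ΣS = begin
  R + 2 + (2 + t * 2) + (R + 2 + (R + sum rest))             ≡⟨ rearrange R t (sum rest) ⟩
  suc R + 1 + 1 + (suc R + 1 + (suc R + (sum rest + t * 2))) ≡⟨ cong (λ s → suc R + 1 + 1 + (suc R + 1 + (suc R + s)))
                                                                     (trans ΣS (sum-withTwos t rest)) ⟨
  sum (butterfly (suc R) S)                                 ∎
  where
  open ≡-Reasoning
  rearrange : ∀ R t m → R + 2 + (2 + t * 2) + (R + 2 + (R + m)) ≡ suc R + 1 + 1 + (suc R + 1 + (suc R + (m + t * 2)))
  rearrange = solve-∀

OO-333 : OO 9 (3 ∷ 3 ∷ 3 ∷ [])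
OO-333 = (refl , s≤s z≤n ∷ s≤s z≤n ∷ s≤s z≤n ∷ [] , ≤-refl ∷ ≤-refl ∷ [-]) , inj₁ refl

oo-valid : ∀ P S → 4 ≤ P → PartSet (P ∸ 1) S → Even P →
  OO (sum (butterfly P S)) (oo (P ∸ 1) (occ 2 (expand S)) (oddParts (expand S)))
oo-valid (suc R) S (s≤s R≥3) S-part P-even with expand-withTwos S S-part
... | _ , bm , md-odd , ΣS = subst (λ m → OO m (oo R t md)) (sum-oo R t md S ΣS) (OO-intro R t md bm md-odd (R-odd , R≥3))
  where
  t = occ 2 (expand S)
  md = oddParts (expand S)
  R-odd = Even-suc⇒Odd {R} (subst Even (+-comm 1 R) P-even)

toOO-valid : ∀ {n l} → ButterflyO n l → OO n (toOO l)
toOO-valid b with ButterflyO-view b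
... | P , S , refl , S-part , P-even , P≥2 , Σl with P ≟ 2
...   | yes refl rewrite PartSet-empty (s≤s (s≤s z≤n)) S-part = subst (λ m → OO m (3 ∷ 3 ∷ 3 ∷ [])) Σl OO-333
...   | no P≢2 = subst (λ m → OO m _) Σl (oo-valid P S (Even-≢2⇒≥4 P-even P≥2 P≢2) S-part P-even)

fromOO-valid : ∀ {n l} → OO n l → ButterflyO n (fromOO l)
fromOO-valid {n} o with OO-view o
... | inj₁ (refl , Σl) = subst (λ m → ButterflyO m (butterfly 2 [])) Σl (ButterflyO-intro 2 [] ([] , [] , []) refl ≤-refl)
... | inj₂ (R , t , rest , refl , bm , _ , (R-odd , R≥3) , Σl) =
  subst (ButterflyO n) (sym (fromOO-oo R t rest))
    (subst (λ m → ButterflyO m (butterfly (suc R) S)) (trans (sym (sum-oo R t rest S (sum-collect R (withTwos t rest) bm))) Σl)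
      (ButterflyO-intro (suc R) S (proj₁ (collect-valid R (withTwos t rest) bm))
         (subst Even (+-comm R 1) (Odd⇒Even-suc {R} R-odd)) (≤-trans (n≤1+n 2) (m≤n⇒m≤1+n R≥3))))
  where
  S = collect R (withTwos t rest)

fromOO-oo-expand : ∀ P S → 1 ≤ P → PartSet (P ∸ 1) S →
  fromOO (oo (P ∸ 1) (occ 2 (expand S)) (oddParts (expand S))) ≡ butterfly P S
fromOO-oo-expand (suc R) S _ S-part =
  trans (fromOO-oo R _ _)
    (cong (butterfly (suc R)) (trans (cong (collect R) (sym (proj₁ (expand-withTwos S S-part)))) (collect-expand R S S-part)))

fromOO-toOO : ∀ {n l} → ButterflyO n l → fromOO (toOO l) ≡ l
fromOO-toOO b with ButterflyO-view b
... | P , S , refl , S-part , P-even , P≥2 , _ with P ≟ 2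
...   | yes refl rewrite PartSet-empty (s≤s (s≤s z≤n)) S-part = refl
...   | no _ = fromOO-oo-expand P S (≤-trans (s≤s z≤n) P≥2) S-part

toOO-fromOO : ∀ {n l} → OO n l → toOO (fromOO l) ≡ l
toOO-fromOO o with OO-view o
... | inj₁ (refl , _) = refl
... | inj₂ (R , t , rest , refl , bm , rest-odd , (_ , R≥3) , _) =
  trans (cong toOO (fromOO-oo R t rest)) (trans (toOO-butterfly (suc R) S (λ { refl → <⇒≱ R≥3 (s≤s z≤n) }))
    (cong₂ (oo R) (trans (cong (occ 2) expand-S) (occ2-withTwos t rest rest≥3))
                  (trans (cong oddParts expand-S) (oddParts-withTwos t rest rest≥3))))
  where
  S = collect R (withTwos t rest)
  rest≥3 = All.map proj₂ rest-odd
  expand-S = proj₂ (collect-valid R (withTwos t rest) bm)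

ButterflyE⇔ : ∀ {m} l → (DistinctNoOneRun₃ m l × Even (second l)) ⇔ ButterflyE m l
ButterflyE⇔ l = mk⇔
  (λ (run₃ , even) → case Equivalence.from (Butterfly⇔DistinctNoOneRun₃ l) run₃ of λ
     { b@(_ , p₁ , p₂ , p₃ , rest , refl , _) → b , p₁ , p₂ , p₃ ∷ rest , refl , even })
  (λ { (b , _ , _ , _ , refl , even) → Equivalence.to (Butterfly⇔DistinctNoOneRun₃ l) b , even })

ButterflyO⇔ : ∀ {m} l → (DistinctNoOneRun₃ m l × ¬ Even (second l)) ⇔ ButterflyO m l
ButterflyO⇔ l = mk⇔
  (λ (run₃ , ¬even) → case Equivalence.from (Butterfly⇔DistinctNoOneRun₃ l) run₃ of λ
     { b@(_ , p₁ , p₂ , p₃ , rest , refl , _) → b , p₁ , p₂ , p₃ ∷ rest , refl , ¬Even⇒Odd p₂ ¬even })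
  (λ { (b , _ , p₂ , _ , refl , odd) → Equivalence.to (Butterfly⇔DistinctNoOneRun₃ l) b , Odd⇒¬Even {p₂} odd })

Counted-OE : ∀ {n m} → Counted (ButterflyE n) m → Counted (OE n) m
Counted-OE = Counted-bijection toOE fromOE (λ _ → toOE-valid) (λ _ → fromOE-valid) (λ _ → fromOE-toOE) (λ _ → toOE-fromOE)

Counted-OO : ∀ {n m} → Counted (ButterflyO n) m → Counted (OO n) m
Counted-OO = Counted-bijection toOO fromOO (λ _ → toOO-valid) (λ _ → fromOO-valid) (λ _ → fromOO-toOO) (λ _ → toOO-fromOO)

proposition3p4 : (n : ℕ) → 6 ≤ n →
    (Σ ℕ λ m → Count (OE n) m × Count (ButterflyE n) m) ×
    (Σ ℕ λ m → Count (OO n) m × Count (ButterflyO n) m) ×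
    (∃ λ a → ∃ λ b → ∃ λ c → ∃ λ d → ∃ λ e →
       Count (OE n) a × Count (OO n) b ×
       Count (IsDistinctPartition n) c ×
       Count (IsDistinctPartition (n ∸ 1)) d ×
       Count (IsDistinctPartition (n ∸ 2)) e ×
       a + b + 2 * d ≡ c + e)
proposition3p4 n n≥6 with Counted-split (λ l → second l % 2 ≟ 0) (proj₂ (Counted-DistinctNoOneRun₃ n))
... | a , b , cEven , cOdd , a+b≡ =
  (a , Counted-OE cBE , cBE) , (b , Counted-OO cBO , cBO) ,
  (a , b , q n , q (n ∸ 1) , q (n ∸ 2) , Counted-OE cBE , Counted-OO cBO , cq n , cq (n ∸ 1) , cq (n ∸ 2) ,
   trans (cong (_+ 2 * q (n ∸ 1)) a+b≡)
         (butterflies-second-difference n≥6 (proj₂ (Counted-DistinctNoOneRun₃ n)) (cq n) (cq (n ∸ 1)) (cq (n ∸ 2))))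
  where
  q : ℕ → ℕ
  q m = proj₁ (Counted-IsDistinctPartition m)
  cq : ∀ m → Counted (IsDistinctPartition m) (q m)
  cq m = proj₂ (Counted-IsDistinctPartition m)
  cBE : Counted (ButterflyE n) a
  cBE = Counted-cong ButterflyE⇔ cEven
  cBO : Counted (ButterflyO n) b
  cBO = Counted-cong ButterflyO⇔ cOdd
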